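{- Let $q=2^r$, let $\lambda$ be the canonical additive character of $\mathbb{F}_q$, and let $a\in\mathbb{F}_q^*$. Then \[ \sum_{ w \in O(3,q)} \lambda(a\, Tr\, w)=\lambda(a)\,q\,K(\lambda ;a ). \]
   Context: $q=2^r$ with $r\ge 1$; $\mathbb{F}_q$ is the field with $q$ elements; $tr(x)=x+x^2+\cdots+x^{2^{r-1}}$ is the absolute trace $\mathbb{F}_q\to\mathbb{F}_2$ and $\lambda(x)=(-1)^{tr(x)}$. $O(3,q)$ is the group of all $w\in GL(3,q)$ preserving the nondegenerate quadratic form $\theta(x_1,x_2,x_3)=x_1x_2+x_3^2$ on column vectors $\mathbb{F}_q^{3\times 1}$; concretely it consists of the matrices $\begin{bmatrix} a'&b&0\\ c&d&0\\ g&h&1\end{bmatrix}\in GL(3,q)$ with $a'c+g^2=0$, $bd+h^2=0$, $a'd+bc=1$. $Tr\,w$ is the matrix trace. $K(\lambda;a)=\sum_{\alpha\in\mathbb{F}_q^*}\lambda(\alpha+a\alpha^{ -1})$ is the Kloosterman sum. -}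

module Defs where

open import Level using (_⊔_)
open import Algebra.Bundles using (CommutativeRing)
open import Data.Nat as ℕ using (ℕ; zero; suc)
open import Data.Integer as ℤ using (ℤ; +_; -[1+_])
open import Data.Bool using (Bool; true; false; if_then_else_; _∧_)
open import Data.Fin using (Fin) renaming (zero to fz; suc to fs)
open import Data.List using (List; []; _∷_; map; concatMap; foldr; length; filter; upTo)
open import Data.List.Relation.Unary.Any using (Any)
open import Data.List.Relation.Unary.AllPairs using (AllPairs)
open import Data.Vec.Functional using (Vector) renaming ([] to []ᵥ; _∷_ to _∷ᵥ_)
open import Relation.Nullary using (¬_; Dec; yes; no)
open import Relation.Nullary.Decidable using (⌊_⌋; ¬?)
open import Relation.Binary using (Decidable)
open import Relation.Binary.PropositionalEquality using (_≡_)

record FiniteField2 {c ℓ} (F : CommutativeRing c ℓ) (r : ℕ) : Set (c ⊔ ℓ) where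
  open CommutativeRing F
  field
    _≟_       : Decidable _≈_
    1≉0       : ¬ (1# ≈ 0#)
    _⁻¹       : Carrier → Carrier
    ⁻¹-inverse : ∀ x → ¬ (x ≈ 0#) → (x * (x ⁻¹)) ≈ 1#
    elems     : List Carrier
    complete  : ∀ x → Any (x ≈_) elems
    unique    : AllPairs (λ x y → ¬ (x ≈ y)) elems
    card      : length elems ≡ 2 ℕ.^ r

module FF {c ℓ} {F : CommutativeRing c ℓ} {r : ℕ} (K : FiniteField2 F r) where
  open CommutativeRing F using (Carrier; _≈_; _+_; _*_; _-_; 0#; 1#)
  open FiniteField2 K

  Σℤ : ∀ {a} {A : Set a} → List A → (A → ℤ) → ℤ
  Σℤ xs f = foldr (λ x s → f x ℤ.+ s) (+ 0) xs

  ΣF : ∀ {a} {A : Set a} → List A → (A → Carrier) → Carrier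
  ΣF xs f = foldr (λ x s → f x + s) 0# xs

  pow : Carrier → ℕ → Carrier
  pow x zero    = 1#
  pow x (suc n) = x * pow x n

  tr : Carrier → Carrier
  tr x = ΣF (upTo r) (λ i → pow x (2 ℕ.^ i))

  -- canonical additive character λ(x) = (-1)^tr(x)  (tr x ∈ {0,1})
  λχ : Carrier → ℤ
  λχ x = if ⌊ tr x ≟ 0# ⌋ then + 1 else -[1+ 0 ]

  elems* : List Carrier
  elems* = filter (λ x → ¬? (x ≟ 0#)) elems

  Kl : Carrier → ℤ
  Kl a = Σℤ elems* (λ α → λχ (α + a * (α ⁻¹)))

  vecs : (n : ℕ) → List (Vector Carrier n)
  vecs zero    = []ᵥ ∷ []
  vecs (suc n) = concatMap (λ x → map (λ v → x ∷ᵥ v) (vecs n)) elems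

  Mat3 : Set c
  Mat3 = Fin 3 → Fin 3 → Carrier

  mats : List Mat3
  mats = vecs 3 |> λ rows → concatMap (λ r0 → concatMap (λ r1 → map (λ r2 → row3 r0 r1 r2) rows) rows) rows
    where
      _|>_ : ∀ {a b} {A : Set a} {B : Set b} → A → (A → B) → B
      x |> f = f x
      row3 : Vector Carrier 3 → Vector Carrier 3 → Vector Carrier 3 → Mat3
      row3 r0 r1 r2 fz = r0
      row3 r0 r1 r2 (fs fz) = r1
      row3 r0 r1 r2 (fs (fs fz)) = r2

  i0 i1 i2 : Fin 3
  i0 = fz
  i1 = fs fz
  i2 = fs (fs fz)

  -- determinant (in characteristic 2 signs are irrelevant, but we use the
  -- general formula with ring negation)
  det : Mat3 → Carrier
  det w = w i0 i0 * (w i1 i1 * w i2 i2 - w i1 i2 * w i2 i1)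
        - w i0 i1 * (w i1 i0 * w i2 i2 - w i1 i2 * w i2 i0)
        + w i0 i2 * (w i1 i0 * w i2 i1 - w i1 i1 * w i2 i0)

  Tr : Mat3 → Carrier
  Tr w = w i0 i0 + w i1 i1 + w i2 i2

  _·_ : Mat3 → Vector Carrier 3 → Vector Carrier 3
  (w · x) i = w i i0 * x i0 + w i i1 * x i1 + w i i2 * x i2

  θ : Vector Carrier 3 → Carrier
  θ x = x i0 * x i1 + x i2 * x i2

  inO3 : Mat3 → Bool
  inO3 w = ⌊ ¬? (det w ≟ 0#) ⌋ ∧ foldr (λ x b → ⌊ θ (w · x) ≟ θ x ⌋ ∧ b) true (vecs 3)

  O3 : List Mat3
  O3 = filter (λ w → T? (inO3 w)) mats
    where open import Data.Bool using (T?)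

  qℤ : ℤ
  qℤ = + (2 ℕ.^ r)

-- In characteristic 2 the elements of O(3,q) are exactly the matrices [[a,b,0],[d,e,0],[√(ad),√(be),1]]
-- with ae + bd = 1, so the sum is Σ_{ae+bd=1} λ(u(a+e+1)).  For fixed a and e the equation bd = 1 + ae
-- has q + (q − 1) solutions (b,d) when ae = 1 and q − 1 otherwise.  The (q − 1)-part contributes nothing,
-- because λ sums to zero along every line x ↦ ux + c (some element has trace one: the trace is a
-- polynomial of degree 2^(r−1) < q).  What remains is q Σ_{a≠0} λ(u(a + a⁻¹ + 1)) = λ(u) q Σ_{a≠0} λ(ua + ua⁻¹),
-- and the substitution β = √(ua), together with λ(x²) = λ(x), turns the last sum into K(λ;u).

module Submission where

open import Defs
open import Level using (Level)
open import Algebra.Bundles using (CommutativeRing; CommutativeMonoid)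
open import Data.Nat as ℕ using (ℕ; zero; suc; _≤_; _≥_; z≤n; s≤s)
import Data.Nat.Properties as ℕ
open import Data.Integer as ℤ using (ℤ; 0ℤ; 1ℤ; -1ℤ) renaming (_+_ to _+ᶻ_; _*_ to _*ᶻ_)
import Data.Integer.Properties as ℤ
open import Data.Integer.Tactic.RingSolver using (solve-∀)
open import Data.Bool using (Bool; true; false; T; T?; if_then_else_; _∧_)
open import Data.Bool.Properties using (T-∧)
open import Data.Fin using () renaming (zero to fzero; suc to fsuc)
open import Data.List using (List; []; _∷_; _++_; map; concatMap; filter; foldr; length; replicate; applyUpTo)
import Data.List.Properties as List
open import Data.List.Relation.Unary.All as All using (All; []; _∷_; lookupAny)
open import Data.List.Relation.Unary.All.Properties using (¬Any⇒All¬; concat⁻; map⁻)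
open import Data.List.Relation.Unary.Any as Any using (here; there; any?; satisfied)
open import Data.List.Relation.Unary.AllPairs using ([]; _∷_)
open import Data.Vec.Functional using (Vector) renaming ([] to []ᵥ; _∷_ to _∷ᵥ_)
open import Data.Product using (Σ-syntax; _×_; _,_; proj₁; proj₂)
open import Data.Sum using (_⊎_; inj₁; inj₂)
open import Function using (id; _∘_)
open import Function.Bundles using (Equivalence)
open import Function.Definitions using (Congruent)
open import Relation.Binary.Bundles using (Setoid)
open import Relation.Nullary using (¬_; Dec; yes; no; contradiction)
open import Relation.Nullary.Decidable using (does; ¬?; _×-dec_; ⌊_⌋; toWitness; fromWitness)
import Relation.Binary.PropositionalEquality as ≡
open ≡ using (_≡_)

module IntegerSum where
  open ≡ using (_≡_; refl; sym; trans; cong; cong₂)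
  open ≡.≡-Reasoning

  private variable
    a b : Level
    X : Set a
    Y : Set b

  ∑ : List X → (X → ℤ) → ℤ
  ∑ xs f = foldr (λ x s → f x +ᶻ s) 0ℤ xs

  ∑-cong : ∀ (xs : List X) {f g : X → ℤ} → (∀ x → f x ≡ g x) → ∑ xs f ≡ ∑ xs g
  ∑-cong []       f≗g = refl
  ∑-cong (x ∷ xs) f≗g = cong₂ _+ᶻ_ (f≗g x) (∑-cong xs f≗g)

  ∑-++ : ∀ (xs ys : List X) (f : X → ℤ) → ∑ (xs ++ ys) f ≡ ∑ xs f +ᶻ ∑ ys f
  ∑-++ []       ys f = sym (ℤ.+-identityˡ _)
  ∑-++ (x ∷ xs) ys f = trans (cong (f x +ᶻ_) (∑-++ xs ys f)) (sym (ℤ.+-assoc (f x) _ _))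

  ∑-map : (h : X → Y) (xs : List X) (f : Y → ℤ) → ∑ (map h xs) f ≡ ∑ xs (f ∘ h)
  ∑-map h []       f = refl
  ∑-map h (x ∷ xs) f = cong (f (h x) +ᶻ_) (∑-map h xs f)

  ∑-concatMap : (h : X → List Y) (xs : List X) (f : Y → ℤ) →
                ∑ (concatMap h xs) f ≡ ∑ xs (λ x → ∑ (h x) f)
  ∑-concatMap h []       f = refl
  ∑-concatMap h (x ∷ xs) f =
    trans (∑-++ (h x) (concatMap h xs) f) (cong (∑ (h x) f +ᶻ_) (∑-concatMap h xs f))

  ∑-filter : ∀ {p} {P : X → Set p} (P? : ∀ x → Dec (P x)) (xs : List X) (f : X → ℤ) →
             ∑ (filter P? xs) f ≡ ∑ xs (λ x → if does (P? x) then f x else 0ℤ)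
  ∑-filter P? []       f = refl
  ∑-filter P? (x ∷ xs) f with P? x
  ... | yes _ = cong (f x +ᶻ_) (∑-filter P? xs f)
  ... | no  _ = trans (∑-filter P? xs f) (sym (ℤ.+-identityˡ _))

  ∑-+ : ∀ (xs : List X) (f g : X → ℤ) → ∑ xs (λ x → f x +ᶻ g x) ≡ ∑ xs f +ᶻ ∑ xs g
  ∑-+ []       f g = refl
  ∑-+ (x ∷ xs) f g = begin
    (f x +ᶻ g x) +ᶻ ∑ xs (λ x → f x +ᶻ g x) ≡⟨ cong ((f x +ᶻ g x) +ᶻ_) (∑-+ xs f g) ⟩
    (f x +ᶻ g x) +ᶻ (∑ xs f +ᶻ ∑ xs g)      ≡⟨ interchange (f x) (g x) (∑ xs f) (∑ xs g) ⟩
    (f x +ᶻ ∑ xs f) +ᶻ (g x +ᶻ ∑ xs g)      ∎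
    where
    interchange : ∀ a b c d → (a +ᶻ b) +ᶻ (c +ᶻ d) ≡ (a +ᶻ c) +ᶻ (b +ᶻ d)
    interchange = solve-∀

  ∑-*ˡ : ∀ (xs : List X) k (f : X → ℤ) → ∑ xs (λ x → k *ᶻ f x) ≡ k *ᶻ ∑ xs f
  ∑-*ˡ []       k f = sym (ℤ.*-zeroʳ k)
  ∑-*ˡ (x ∷ xs) k f = trans (cong (k *ᶻ f x +ᶻ_) (∑-*ˡ xs k f)) (sym (ℤ.*-distribˡ-+ k (f x) _))

  ∑-*ʳ : ∀ (xs : List X) k (f : X → ℤ) → ∑ xs (λ x → f x *ᶻ k) ≡ ∑ xs f *ᶻ k
  ∑-*ʳ xs k f = trans (∑-cong xs (λ x → ℤ.*-comm (f x) k)) (trans (∑-*ˡ xs k f) (ℤ.*-comm k _))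

  ∑-zero : ∀ (xs : List X) → ∑ xs (λ _ → 0ℤ) ≡ 0ℤ
  ∑-zero []       = refl
  ∑-zero (x ∷ xs) = trans (ℤ.+-identityˡ _) (∑-zero xs)

  ∑-const : ∀ (xs : List X) k → ∑ xs (λ _ → k) ≡ ℤ.+ length xs *ᶻ k
  ∑-const []       k = sym (ℤ.*-zeroˡ k)
  ∑-const (x ∷ xs) k = begin
    k +ᶻ ∑ xs (λ _ → k)              ≡⟨ cong (k +ᶻ_) (∑-const xs k) ⟩
    k +ᶻ ℤ.+ length xs *ᶻ k          ≡⟨ cong (_+ᶻ ℤ.+ length xs *ᶻ k) (ℤ.*-identityˡ k) ⟨
    1ℤ *ᶻ k +ᶻ ℤ.+ length xs *ᶻ k    ≡⟨ ℤ.*-distribʳ-+ k 1ℤ (ℤ.+ length xs) ⟨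
    (1ℤ +ᶻ ℤ.+ length xs) *ᶻ k       ∎

  ∑-comm : (xs : List X) (ys : List Y) (f : X → Y → ℤ) →
           ∑ xs (λ x → ∑ ys (f x)) ≡ ∑ ys (λ y → ∑ xs (λ x → f x y))
  ∑-comm []       ys f = sym (∑-zero ys)
  ∑-comm (x ∷ xs) ys f =
    trans (cong (∑ ys (f x) +ᶻ_) (∑-comm xs ys f)) (sym (∑-+ ys (f x) (λ y → ∑ xs (λ x → f x y))))

module Reindexing {a ℓ} (S : Setoid a ℓ) where
  open Setoid S renaming (Carrier to X)
  open import Data.List.Membership.Setoid S using (_∈_; _∉_)
  open import Data.List.Membership.Setoid.Properties using (∈-∃++; ∈-resp-≈; ∈-map⁺; ∈-map⁻; All[≉]⇒∉)
  open import Data.List.Relation.Unary.Unique.Setoid S using (Unique)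
  open import Data.List.Relation.Unary.Unique.Setoid.Properties using (map⁺)
  open import Data.List.Relation.Binary.Permutation.Setoid S
    using (_↭_; ↭-refl; ↭-trans; ↭-sym; ↭-transˡ-≋; prep)
  open import Data.List.Relation.Binary.Permutation.Setoid.Properties S
    using (∈-resp-↭; Unique-resp-↭; ↭-shift)
  import Data.List.Relation.Binary.Permutation.Setoid.Properties as Perm

  unique-⊆⇒↭ : ∀ {xs ys} → Unique xs → Unique ys →
               (∀ {z} → z ∈ xs → z ∈ ys) → (∀ {z} → z ∈ ys → z ∈ xs) → xs ↭ ys
  unique-⊆⇒↭ {[]}     {[]}     _ _ _ _ = ↭-refl
  unique-⊆⇒↭ {[]}     {y ∷ ys} _ _ _ ys⊆ with ys⊆ (here refl)
  ... | ()
  unique-⊆⇒↭ {x ∷ xs} {ys} (x≉xs ∷ xs!) ys! xs⊆ ys⊆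
    with as , bs , w , x≈w , ys≋ ← ∈-∃++ S (xs⊆ (here refl)) =
    ↭-trans (prep x≈w (unique-⊆⇒↭ xs! as++bs! xs⊆as++bs as++bs⊆xs)) (↭-sym ys↭)
    where
    ys↭ : ys ↭ w ∷ as ++ bs
    ys↭ = ↭-transˡ-≋ ys≋ (↭-shift as bs)
    w∷as++bs! : Unique (w ∷ as ++ bs)
    w∷as++bs! = Unique-resp-↭ ys↭ ys!
    w∉as++bs : w ∉ as ++ bs
    w∉as++bs with w≉ ∷ _ ← w∷as++bs! = All[≉]⇒∉ S w≉
    as++bs! : Unique (as ++ bs)
    as++bs! with _ ∷ u ← w∷as++bs! = u
    xs⊆as++bs : ∀ {z} → z ∈ xs → z ∈ as ++ bs
    xs⊆as++bs z∈xs with ∈-resp-↭ ys↭ (xs⊆ (there z∈xs))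
    ... | here z≈w    = contradiction (∈-resp-≈ S (trans z≈w (sym x≈w)) z∈xs) (All[≉]⇒∉ S x≉xs)
    ... | there z∈as++bs = z∈as++bs
    as++bs⊆xs : ∀ {z} → z ∈ as ++ bs → z ∈ xs
    as++bs⊆xs z∈ with ys⊆ (∈-resp-↭ (↭-sym ys↭) (there z∈))
    ... | here z≈x = contradiction (∈-resp-≈ S (trans z≈x x≈w) z∈) w∉as++bs
    ... | there z∈xs = z∈xs

  module _ {m ℓm} (M : CommutativeMonoid m ℓm) where
    open CommutativeMonoid M using (_∙_; ε; isCommutativeMonoid)
      renaming (Carrier to C; _≈_ to _≈ᴹ_; setoid to setoidᴹ)
    open import Relation.Binary.Reasoning.Setoid setoidᴹ

    ∑ᴹ : List X → (X → C) → C
    ∑ᴹ xs f = foldr (λ x s → f x ∙ s) ε xs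

    ∑ᴹ-resp-↭ : ∀ {f : X → C} → Congruent _≈_ _≈ᴹ_ f → ∀ {xs ys} → xs ↭ ys → ∑ᴹ xs f ≈ᴹ ∑ᴹ ys f
    ∑ᴹ-resp-↭ {f} f-cong {xs} {ys} xs↭ys = begin
      ∑ᴹ xs f                 ≡⟨ List.foldr-map _∙_ f ε xs ⟨
      foldr _∙_ ε (map f xs)  ≈⟨ Perm.foldr-commMonoid setoidᴹ isCommutativeMonoid
                                   (Perm.map⁺ S setoidᴹ f-cong xs↭ys) ⟩
      foldr _∙_ ε (map f ys)  ≡⟨ List.foldr-map _∙_ f ε ys ⟩
      ∑ᴹ ys f                 ∎

    ∑ᴹ-reindex : ∀ {f : X → C} → Congruent _≈_ _≈ᴹ_ f →
                 ∀ {φ : X → X} → Congruent _≈_ _≈_ φ → (∀ {x y} → φ x ≈ φ y → x ≈ y) →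
                 ∀ {xs} → Unique xs → (∀ {x} → x ∈ xs → φ x ∈ xs) →
                 (∀ {y} → y ∈ xs → Σ[ x ∈ X ] x ∈ xs × y ≈ φ x) →
                 ∑ᴹ xs (f ∘ φ) ≈ᴹ ∑ᴹ xs f
    ∑ᴹ-reindex {f} f-cong {φ} φ-cong φ-injective {xs} xs! φ-into φ-onto = begin
      ∑ᴹ xs (f ∘ φ)      ≡⟨ List.foldr-map (λ x s → f x ∙ s) φ ε xs ⟨
      ∑ᴹ (map φ xs) f    ≈⟨ ∑ᴹ-resp-↭ f-cong (unique-⊆⇒↭ (map⁺ S S φ-injective xs!) xs! into onto) ⟩
      ∑ᴹ xs f            ∎
      where
      into : ∀ {z} → z ∈ map φ xs → z ∈ xs
      into z∈ with x , x∈ , z≈φx ← ∈-map⁻ S S z∈ = ∈-resp-≈ S (sym z≈φx) (φ-into x∈)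
      onto : ∀ {y} → y ∈ xs → y ∈ map φ xs
      onto y∈ with x , x∈ , y≈φx ← φ-onto y∈ = ∈-resp-≈ S (sym y≈φx) (∈-map⁺ S S φ-cong x∈)

module FieldFacts {c ℓ} {F : CommutativeRing c ℓ} {r : ℕ} (K : FiniteField2 F r) where
  open CommutativeRing F renaming (Carrier to A)
  open FiniteField2 K
  open FF K using (elems*; pow)
  open import Data.List.Membership.Setoid setoid using (_∈_)
  open import Data.List.Membership.Setoid.Properties using (∈-filter⁺; ∈-filter⁻)
  open import Data.List.Relation.Unary.Unique.Setoid setoid using (Unique)
  import Data.List.Relation.Unary.Unique.Setoid.Properties as Unique
  open import Relation.Binary.Reasoning.Setoid setoid
  open import Algebra.Solver.Ring.NaturalCoefficients.Default commutativeSemiring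

  x⁻¹*[x*y]≈y : ∀ {x} y → x ≉ 0# → x ⁻¹ * (x * y) ≈ y
  x⁻¹*[x*y]≈y {x} y x≉0 = begin
    x ⁻¹ * (x * y) ≈⟨ solve 3 (λ x x⁻¹ y → x⁻¹ :* (x :* y) := (x :* x⁻¹) :* y) refl x (x ⁻¹) y ⟩
    (x * x ⁻¹) * y ≈⟨ *-congʳ (⁻¹-inverse x x≉0) ⟩
    1# * y         ≈⟨ *-identityˡ y ⟩
    y              ∎

  x*[x⁻¹*y]≈y : ∀ {x} y → x ≉ 0# → x * (x ⁻¹ * y) ≈ y
  x*[x⁻¹*y]≈y {x} y x≉0 = begin
    x * (x ⁻¹ * y) ≈⟨ *-assoc x (x ⁻¹) y ⟨
    (x * x ⁻¹) * y ≈⟨ *-congʳ (⁻¹-inverse x x≉0) ⟩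
    1# * y         ≈⟨ *-identityˡ y ⟩
    y              ∎

  *-cancelˡ : ∀ {x y z} → x ≉ 0# → x * y ≈ x * z → y ≈ z
  *-cancelˡ {x} {y} {z} x≉0 xy≈xz = begin
    y              ≈⟨ x⁻¹*[x*y]≈y y x≉0 ⟨
    x ⁻¹ * (x * y) ≈⟨ *-congˡ xy≈xz ⟩
    x ⁻¹ * (x * z) ≈⟨ x⁻¹*[x*y]≈y z x≉0 ⟩
    z              ∎

  x*y≈0⇒x≈0⊎y≈0 : ∀ {x y} → x * y ≈ 0# → x ≈ 0# ⊎ y ≈ 0#
  x*y≈0⇒x≈0⊎y≈0 {x} {y} xy≈0 with x ≟ 0#
  ... | yes x≈0 = inj₁ x≈0
  ... | no  x≉0 = inj₂ (*-cancelˡ x≉0 (trans xy≈0 (sym (zeroʳ x))))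

  x*y≉0 : ∀ {x y} → x ≉ 0# → y ≉ 0# → x * y ≉ 0#
  x*y≉0 x≉0 y≉0 xy≈0 with x*y≈0⇒x≈0⊎y≈0 xy≈0
  ... | inj₁ x≈0 = x≉0 x≈0
  ... | inj₂ y≈0 = y≉0 y≈0

  x*y≈1⇒x≉0 : ∀ {x y} → x * y ≈ 1# → x ≉ 0#
  x*y≈1⇒x≉0 {x} {y} xy≈1 x≈0 = 1≉0 (trans (sym xy≈1) (trans (*-congʳ x≈0) (zeroˡ y)))

  x⁻¹≉0 : ∀ {x} → x ≉ 0# → x ⁻¹ ≉ 0#
  x⁻¹≉0 {x} x≉0 = x*y≈1⇒x≉0 (trans (*-comm _ x) (⁻¹-inverse x x≉0))

  ⁻¹-unique : ∀ {x y} → x * y ≈ 1# → y ≈ x ⁻¹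
  ⁻¹-unique {x} xy≈1 = *-cancelˡ x≉0 (trans xy≈1 (sym (⁻¹-inverse x x≉0)))
    where
    x≉0 : x ≉ 0#
    x≉0 = x*y≈1⇒x≉0 xy≈1

  ⁻¹-cong : ∀ {x y} → x ≈ y → x ≉ 0# → x ⁻¹ ≈ y ⁻¹
  ⁻¹-cong {x} x≈y x≉0 = ⁻¹-unique (trans (*-congʳ (sym x≈y)) (⁻¹-inverse x x≉0))

  pow≉0 : ∀ {x} n → x ≉ 0# → pow x n ≉ 0#
  pow≉0 zero    x≉0 = 1≉0
  pow≉0 (suc n) x≉0 = x*y≉0 x≉0 (pow≉0 n x≉0)

  pow-cong : ∀ {x y} n → x ≈ y → pow x n ≈ pow y n
  pow-cong zero    x≈y = refl
  pow-cong (suc n) x≈y = *-cong x≈y (pow-cong n x≈y)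

  pow-+ : ∀ x m n → pow x (m ℕ.+ n) ≈ pow x m * pow x n
  pow-+ x zero    n = sym (*-identityˡ _)
  pow-+ x (suc m) n = trans (*-congˡ (pow-+ x m n)) (sym (*-assoc _ _ _))

  pow-distrib-* : ∀ x y n → pow (x * y) n ≈ pow x n * pow y n
  pow-distrib-* x y zero    = sym (*-identityˡ 1#)
  pow-distrib-* x y (suc n) = trans (*-congˡ (pow-distrib-* x y n))
    (solve 4 (λ x y xⁿ yⁿ → (x :* y) :* (xⁿ :* yⁿ) := (x :* xⁿ) :* (y :* yⁿ)) refl x y (pow x n) (pow y n))

  nonzero? : ∀ x → Dec (x ≉ 0#)
  nonzero? x = ¬? (x ≟ 0#)

  ≉0-resp : ∀ {x y} → x ≈ y → x ≉ 0# → y ≉ 0#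
  ≉0-resp x≈y x≉0 y≈0 = x≉0 (trans x≈y y≈0)

  ∈-elems* : ∀ {x} → x ≉ 0# → x ∈ elems*
  ∈-elems* x≉0 = ∈-filter⁺ setoid nonzero? ≉0-resp (complete _) x≉0

  ∈-elems*⇒≉0 : ∀ {x} → x ∈ elems* → x ≉ 0#
  ∈-elems*⇒≉0 x∈ = proj₂ (∈-filter⁻ setoid nonzero? ≉0-resp {xs = elems} x∈)

  elems*! : Unique elems*
  elems*! = Unique.filter⁺ setoid nonzero? unique


module FieldSums {c ℓ} {F : CommutativeRing c ℓ} {r : ℕ} (K : FiniteField2 F r) where
  open CommutativeRing F renaming (Carrier to A)
  open FiniteField2 K
  open FF K using (elems*)
  open FieldFacts K
  open IntegerSum
  open Reindexing setoid
  open import Data.List.Membership.Setoid setoid using (_∈_; _∉_)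
  open import Data.List.Membership.Setoid.Properties using (∈-resp-≈; All[≉]⇒∉)
  open import Data.List.Relation.Unary.Unique.Setoid setoid using (Unique)
  open import Algebra.Properties.Group +-group using (//-rightDividesˡ; quasigroup)
  open import Algebra.Properties.Quasigroup quasigroup using () renaming (cancelʳ to +-cancelʳ)
  open ≡.≡-Reasoning

  𝟙 : Bool → ℤ
  𝟙 b = if b then 1ℤ else 0ℤ

  𝟙-∧ : ∀ a b → 𝟙 (a ∧ b) ≡ 𝟙 a *ᶻ 𝟙 b
  𝟙-∧ true  b = ≡.sym (ℤ.*-identityˡ (𝟙 b))
  𝟙-∧ false b = ≡.sym (ℤ.*-zeroˡ (𝟙 b))

  δ : A → A → ℤ
  δ x y = 𝟙 (does (x ≟ y))

  𝟙≉0 : A → ℤ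
  𝟙≉0 x = 𝟙 (does (nonzero? x))

  𝟙≉0-*-cong : ∀ {h : A → ℤ} → (∀ {x y} → x ≈ y → x ≉ 0# → h x ≡ h y) → Congruent _≈_ _≡_ (λ x → 𝟙≉0 x *ᶻ h x)
  𝟙≉0-*-cong {h} h-cong {x} {y} x≈y with x ≟ 0# | y ≟ 0#
  ... | yes _   | yes _   = ≡.refl
  ... | yes x≈0 | no  y≉0 = contradiction (trans (sym x≈y) x≈0) y≉0
  ... | no  x≉0 | yes y≈0 = contradiction (trans x≈y y≈0) x≉0
  ... | no  x≉0 | no  _   = ≡.cong (1ℤ *ᶻ_) (h-cong x≈y x≉0)

  δ-≈ : ∀ {x y} → x ≈ y → δ x y ≡ 1ℤ
  δ-≈ {x} {y} x≈y with x ≟ y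
  ... | yes _   = ≡.refl
  ... | no  x≉y = contradiction x≈y x≉y

  δ-≉ : ∀ {x y} → x ≉ y → δ x y ≡ 0ℤ
  δ-≉ {x} {y} x≉y with x ≟ y
  ... | yes x≈y = contradiction x≈y x≉y
  ... | no  _   = ≡.refl

  𝟙≉0-≈0 : ∀ {x} → x ≈ 0# → 𝟙≉0 x ≡ 0ℤ
  𝟙≉0-≈0 {x} x≈0 with x ≟ 0#
  ... | yes _   = ≡.refl
  ... | no  x≉0 = contradiction x≈0 x≉0

  𝟙≉0-≉0 : ∀ {x} → x ≉ 0# → 𝟙≉0 x ≡ 1ℤ
  𝟙≉0-≉0 {x} x≉0 with x ≟ 0#
  ... | yes x≈0 = contradiction x≈0 x≉0
  ... | no  _   = ≡.refl

  𝟙≉0-iff : ∀ {x y} → (x ≈ 0# → y ≈ 0#) → (y ≈ 0# → x ≈ 0#) → 𝟙≉0 x ≡ 𝟙≉0 y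
  𝟙≉0-iff {x} x≈0⇒y≈0 y≈0⇒x≈0 with x ≟ 0#
  ... | yes x≈0 = ≡.sym (𝟙≉0-≈0 (x≈0⇒y≈0 x≈0))
  ... | no  x≉0 = ≡.sym (𝟙≉0-≉0 (x≉0 ∘ y≈0⇒x≈0))

  δ-iff : ∀ {x y x′ y′} → (x ≈ y → x′ ≈ y′) → (x′ ≈ y′ → x ≈ y) → δ x y ≡ δ x′ y′
  δ-iff {x} {y} x≈y⇒x′≈y′ x′≈y′⇒x≈y with x ≟ y
  ... | yes x≈y = ≡.sym (δ-≈ (x≈y⇒x′≈y′ x≈y))
  ... | no  x≉y = ≡.sym (δ-≉ (x≉y ∘ x′≈y′⇒x≈y))

  δ-cong : ∀ {x x′ y y′} → x ≈ x′ → y ≈ y′ → δ x y ≡ δ x′ y′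
  δ-cong x≈x′ y≈y′ = δ-iff (λ x≈y → trans (sym x≈x′) (trans x≈y y≈y′)) (λ x′≈y′ → trans x≈x′ (trans x′≈y′ (sym y≈y′)))

  ∑-δ-∉ : ∀ {v xs} → v ∉ xs → ∑ xs (λ x → δ x v) ≡ 0ℤ
  ∑-δ-∉ {xs = []}     _   = ≡.refl
  ∑-δ-∉ {xs = x ∷ xs} v∉ =
    ≡.cong₂ _+ᶻ_ (δ-≉ (λ x≈v → v∉ (here (sym x≈v)))) (∑-δ-∉ (v∉ ∘ there))

  ∑-δ-∈ : ∀ {v xs} → Unique xs → v ∈ xs → ∑ xs (λ x → δ x v) ≡ 1ℤ
  ∑-δ-∈ {v} {x ∷ xs} (x≉xs ∷ xs!) v∈ with x ≟ v | v∈
  ... | yes x≈v | _          = ≡.cong (1ℤ +ᶻ_) (∑-δ-∉ λ v∈xs →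
                                 All[≉]⇒∉ setoid x≉xs (∈-resp-≈ setoid (sym x≈v) v∈xs))
  ... | no  x≉v | here v≈x   = contradiction (sym v≈x) x≉v
  ... | no  x≉v | there v∈xs = ≡.trans (ℤ.+-identityˡ _) (∑-δ-∈ xs! v∈xs)

  ∑-δ : ∀ v → ∑ elems (λ x → δ x v) ≡ 1ℤ
  ∑-δ v = ∑-δ-∈ unique (complete v)

  ∑-δ-* : ∀ {f : A → ℤ} → Congruent _≈_ _≡_ f → ∀ v → ∑ elems (λ x → δ x v *ᶻ f x) ≡ f v
  ∑-δ-* {f} f-cong v = begin
    ∑ elems (λ x → δ x v *ᶻ f x) ≡⟨ ∑-cong elems δ*f≡δ*fv ⟩
    ∑ elems (λ x → δ x v *ᶻ f v) ≡⟨ ∑-*ʳ elems (f v) (λ x → δ x v) ⟩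
    ∑ elems (λ x → δ x v) *ᶻ f v ≡⟨ ≡.cong (_*ᶻ f v) (∑-δ v) ⟩
    1ℤ *ᶻ f v                    ≡⟨ ℤ.*-identityˡ (f v) ⟩
    f v                          ∎
    where
    δ*f≡δ*fv : ∀ x → δ x v *ᶻ f x ≡ δ x v *ᶻ f v
    δ*f≡δ*fv x with x ≟ v
    ... | yes x≈v = ≡.cong (1ℤ *ᶻ_) (f-cong x≈v)
    ... | no  _   = ≡.trans (ℤ.*-zeroˡ (f x)) (≡.sym (ℤ.*-zeroˡ (f v)))

  ∑-*-δ : ∀ k v → ∑ elems (λ x → k *ᶻ δ x v) ≡ k
  ∑-*-δ k v = ≡.trans (∑-cong elems (λ x → ℤ.*-comm k (δ x v))) (∑-δ-* (λ _ → ≡.refl) v)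

  𝟙-* : ∀ b k → (if b then k else 0ℤ) ≡ 𝟙 b *ᶻ k
  𝟙-* true  k = ≡.sym (ℤ.*-identityˡ k)
  𝟙-* false k = ≡.sym (ℤ.*-zeroˡ k)

  𝟙-does-*-cong : ∀ {p} {P : Set p} (p? : Dec P) {x y} → (P → x ≡ y) → 𝟙 (does p?) *ᶻ x ≡ 𝟙 (does p?) *ᶻ y
  𝟙-does-*-cong (yes p) x≡y = ≡.cong (1ℤ *ᶻ_) (x≡y p)
  𝟙-does-*-cong (no _) {x} {y} _ = ≡.trans (ℤ.*-zeroˡ x) (≡.sym (ℤ.*-zeroˡ y))

  ∑-elems* : ∀ f → ∑ elems* f ≡ ∑ elems (λ x → 𝟙≉0 x *ᶻ f x)
  ∑-elems* f = ≡.trans (∑-filter nonzero? elems f) (∑-cong elems (λ x → 𝟙-* (does (nonzero? x)) (f x)))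

  ∑-𝟙≉0 : ∑ elems 𝟙≉0 ≡ ℤ.+ length elems*
  ∑-𝟙≉0 = begin
    ∑ elems 𝟙≉0                      ≡⟨ ∑-cong elems (λ x → ℤ.*-identityʳ (𝟙≉0 x)) ⟨
    ∑ elems (λ x → 𝟙≉0 x *ᶻ 1ℤ)      ≡⟨ ∑-elems* (λ _ → 1ℤ) ⟨
    ∑ elems* (λ _ → 1ℤ)              ≡⟨ ∑-const elems* 1ℤ ⟩
    ℤ.+ length elems* *ᶻ 1ℤ          ≡⟨ ℤ.*-identityʳ _ ⟩
    ℤ.+ length elems*                ∎

  q≡1+|F*| : 2 ℕ.^ r ≡ suc (length elems*)
  q≡1+|F*| = ℤ.+-injective (begin
    ℤ.+ (2 ℕ.^ r)                      ≡⟨ ≡.cong ℤ.+_ card ⟨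
    ℤ.+ length elems                   ≡⟨ ℤ.*-identityʳ _ ⟨
    ℤ.+ length elems *ᶻ 1ℤ             ≡⟨ ∑-const elems 1ℤ ⟨
    ∑ elems (λ _ → 1ℤ)                 ≡⟨ ∑-cong elems δ+𝟙≉0≡1 ⟨
    ∑ elems (λ x → δ x 0# +ᶻ 𝟙≉0 x)    ≡⟨ ∑-+ elems (λ x → δ x 0#) 𝟙≉0 ⟩
    ∑ elems (λ x → δ x 0#) +ᶻ ∑ elems 𝟙≉0 ≡⟨ ≡.cong₂ _+ᶻ_ (∑-δ 0#) ∑-𝟙≉0 ⟩
    ℤ.+ suc (length elems*)            ∎)
    where
    δ+𝟙≉0≡1 : ∀ x → δ x 0# +ᶻ 𝟙≉0 x ≡ 1ℤ
    δ+𝟙≉0≡1 x with x ≟ 0#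
    ... | yes _ = ≡.refl
    ... | no  _ = ≡.refl

  ∑-reindex : ∀ {f : A → ℤ} → Congruent _≈_ _≡_ f →
              ∀ {φ : A → A} → Congruent _≈_ _≈_ φ → (∀ {x y} → φ x ≈ φ y → x ≈ y) →
              (∀ y → Σ[ x ∈ A ] y ≈ φ x) → ∑ elems (f ∘ φ) ≡ ∑ elems f
  ∑-reindex f-cong φ-cong φ-injective φ-onto =
    ∑ᴹ-reindex ℤ.+-0-commutativeMonoid f-cong φ-cong φ-injective unique
      (λ _ → complete _) (λ {y} _ → let x , y≈φx = φ-onto y in x , complete x , y≈φx)

  ∑-affine : ∀ {f : A → ℤ} → Congruent _≈_ _≡_ f → ∀ {a} b → a ≉ 0# →
             ∑ elems (λ x → f (a * x + b)) ≡ ∑ elems f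
  ∑-affine f-cong {a} b a≉0 = ∑-reindex f-cong (λ x≈y → +-congʳ (*-congˡ x≈y))
    (λ {x} {y} eq → *-cancelˡ a≉0 (+-cancelʳ b (a * x) (a * y) eq))
    (λ y → a ⁻¹ * (y - b) , sym (trans (+-congʳ (x*[x⁻¹*y]≈y (y - b) a≉0)) (//-rightDividesˡ b y)))

module CharacteristicTwo {c ℓ} {F : CommutativeRing c ℓ} {r : ℕ} (K : FiniteField2 F r) where
  open CommutativeRing F renaming (Carrier to A)
  open FiniteField2 K
  open FF K using (ΣF; elems*; pow)
  open FieldFacts K
  open FieldSums K using (q≡1+|F*|)
  open Reindexing setoid using (∑ᴹ; ∑ᴹ-reindex)
  open import Data.List.Membership.Setoid setoid using (_∈_)
  open import Algebra.Definitions.RawMonoid +-rawMonoid using () renaming (_×_ to _×₊_)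
  open import Algebra.Properties.Semiring.Mult semiring using (×1-homo-*)
  open import Algebra.Properties.Group +-group using (inverseˡ-unique; inverseʳ-unique; quasigroup; //-rightDividesˡ)
  open import Algebra.Properties.Quasigroup quasigroup using () renaming (cancelˡ to +-cancelˡ; cancelʳ to +-cancelʳ)
  open import Relation.Binary.Reasoning.Setoid setoid
  open import Algebra.Solver.Ring.NaturalCoefficients.Default commutativeSemiring

  ΣF-+1 : ∀ xs → ΣF xs (λ x → x + 1#) ≈ ΣF xs id + length xs ×₊ 1#
  ΣF-+1 []       = sym (+-identityˡ 0#)
  ΣF-+1 (x ∷ xs) = trans (+-congˡ (ΣF-+1 xs))
    (solve 4 (λ x s n 1′ → (x :+ 1′) :+ (s :+ n) := (x :+ s) :+ (1′ :+ n)) refl x (ΣF xs id) (length xs ×₊ 1#) 1#)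

  q×1≈0 : (2 ℕ.^ r) ×₊ 1# ≈ 0#
  q×1≈0 = +-cancelˡ (ΣF elems id) ((2 ℕ.^ r) ×₊ 1#) 0# (begin
    ΣF elems id + (2 ℕ.^ r) ×₊ 1#    ≈⟨ +-congˡ (reflexive (≡.cong (_×₊ 1#) card)) ⟨
    ΣF elems id + length elems ×₊ 1# ≈⟨ ΣF-+1 elems ⟨
    ΣF elems (λ x → x + 1#)        ≈⟨ shift ⟩
    ΣF elems id                    ≈⟨ +-identityʳ _ ⟨
    ΣF elems id + 0#               ∎)
    where
    shift : ΣF elems (λ x → x + 1#) ≈ ΣF elems id
    shift = ∑ᴹ-reindex +-commutativeMonoid id +-congʳ (+-cancelʳ 1# _ _) unique
      (λ _ → complete _) (λ {y} _ → y - 1# , complete _ , sym (//-rightDividesˡ 1# y))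

  2^n×1≈[2×1]^n : ∀ n → (2 ℕ.^ n) ×₊ 1# ≈ pow (2 ×₊ 1#) n
  2^n×1≈[2×1]^n zero    = +-identityʳ 1#
  2^n×1≈[2×1]^n (suc n) = trans (×1-homo-* 2 (2 ℕ.^ n)) (*-congˡ (2^n×1≈[2×1]^n n))

  2≈0 : 2 ×₊ 1# ≈ 0#
  2≈0 with (2 ×₊ 1#) ≟ 0#
  ... | yes 2≈0 = 2≈0
  ... | no  2≉0 = contradiction (trans (sym (2^n×1≈[2×1]^n r)) q×1≈0) (pow≉0 r 2≉0)

  x+x≈0 : ∀ x → x + x ≈ 0#
  x+x≈0 x = begin
    x + x          ≈⟨ solve 1 (λ x → x :+ x := (con 1 :+ (con 1 :+ con 0)) :* x) refl x ⟩
    (2 ×₊ 1#) * x   ≈⟨ *-congʳ 2≈0 ⟩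
    0# * x         ≈⟨ zeroˡ x ⟩
    0#             ∎

  -x≈x : ∀ x → - x ≈ x
  -x≈x x = sym (inverseʳ-unique x x (x+x≈0 x))

  x+y≈0⇒x≈y : ∀ {x y} → x + y ≈ 0# → x ≈ y
  x+y≈0⇒x≈y {x} {y} x+y≈0 = begin
    x             ≈⟨ inverseˡ-unique x y x+y≈0 ⟩
    - y           ≈⟨ -x≈x y ⟩
    y             ∎

  x≈y⇒x+y≈0 : ∀ {x y} → x ≈ y → x + y ≈ 0#
  x≈y⇒x+y≈0 {x} {y} x≈y = trans (+-congʳ x≈y) (x+x≈0 y)

  x+y≈z⇒y≈x+z : ∀ {x y z} → x + y ≈ z → y ≈ x + z
  x+y≈z⇒y≈x+z {x} {y} {z} x+y≈z = begin
    y             ≈⟨ +-identityˡ y ⟨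
    0# + y        ≈⟨ +-congʳ (x+x≈0 x) ⟨
    (x + x) + y   ≈⟨ +-assoc x x y ⟩
    x + (x + y)   ≈⟨ +-congˡ x+y≈z ⟩
    x + z         ∎

  y≈x+z⇒x+y≈z : ∀ {x y z} → y ≈ x + z → x + y ≈ z
  y≈x+z⇒x+y≈z {x} {y} {z} y≈x+z = begin
    x + y         ≈⟨ +-congˡ y≈x+z ⟩
    x + (x + z)   ≈⟨ +-assoc x x z ⟨
    (x + x) + z   ≈⟨ +-congʳ (x+x≈0 x) ⟩
    0# + z        ≈⟨ +-identityˡ z ⟩
    z             ∎

  ∏ : List A → (A → A) → A
  ∏ = ∑ᴹ *-commutativeMonoid

  ∏-scale : ∀ x xs → ∏ xs (x *_) ≈ pow x (length xs) * ∏ xs id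
  ∏-scale x []       = sym (*-identityˡ 1#)
  ∏-scale x (y ∷ xs) = trans (*-congˡ (∏-scale x xs))
    (solve 4 (λ x y xⁿ p → (x :* y) :* (xⁿ :* p) := (x :* xⁿ) :* (y :* p)) refl x y (pow x (length xs)) (∏ xs id))

  ∏≉0 : ∀ xs → (∀ {z} → z ∈ xs → z ≉ 0#) → ∏ xs id ≉ 0#
  ∏≉0 []       _     = 1≉0
  ∏≉0 (x ∷ xs) xs≉0 = x*y≉0 (xs≉0 (here refl)) (∏≉0 xs (λ z∈ → xs≉0 (there z∈)))

  x^|F*|≈1 : ∀ {x} → x ≉ 0# → pow x (length elems*) ≈ 1#
  x^|F*|≈1 {x} x≉0 = *-cancelˡ P≉0 (begin
    P * pow x (length elems*) ≈⟨ *-comm P _ ⟩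
    pow x (length elems*) * P ≈⟨ ∏-scale x elems* ⟨
    ∏ elems* (x *_)           ≈⟨ ∑ᴹ-reindex *-commutativeMonoid id *-congˡ (*-cancelˡ x≉0) elems*!
                                   (λ y∈ → ∈-elems* (x*y≉0 x≉0 (∈-elems*⇒≉0 y∈)))
                                   (λ {y} y∈ → x ⁻¹ * y , ∈-elems* (x*y≉0 (x⁻¹≉0 x≉0) (∈-elems*⇒≉0 y∈))
                                             , sym (x*[x⁻¹*y]≈y y x≉0)) ⟩
    P                         ≈⟨ *-identityʳ P ⟨
    P * 1#                    ∎)
    where
    P : A
    P = ∏ elems* id
    P≉0 : P ≉ 0#
    P≉0 = ∏≉0 elems* ∈-elems*⇒≉0

  fermat : ∀ x → pow x (2 ℕ.^ r) ≈ x
  fermat x rewrite q≡1+|F*| with x ≟ 0#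
  ... | yes x≈0 = trans (*-congʳ x≈0) (trans (zeroˡ _) (sym x≈0))
  ... | no  x≉0 = trans (*-congˡ (x^|F*|≈1 x≉0)) (*-identityʳ x)

module AbsoluteTrace {c ℓ} {F : CommutativeRing c ℓ} {r : ℕ} (K : FiniteField2 F r) where
  open CommutativeRing F renaming (Carrier to A)
  open FiniteField2 K
  open FF K using (ΣF; pow; tr; λχ)
  open FieldFacts K
  open CharacteristicTwo K
  open import Relation.Binary.Reasoning.Setoid setoid
  open import Algebra.Solver.Ring.NaturalCoefficients.Default commutativeSemiring

  infixl 10 _²
  _² : A → A
  x ² = x * x

  ²-cong : ∀ {x y} → x ≈ y → x ² ≈ y ²
  ²-cong x≈y = *-cong x≈y x≈y

  ²-+ : ∀ x y → (x + y) ² ≈ x ² + y ²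
  ²-+ x y = begin
    (x + y) ²                     ≈⟨ solve 2 (λ x y → (x :+ y) :* (x :+ y) := (x :* x :+ y :* y) :+ x :* y :+ x :* y) refl x y ⟩
    x ² + y ² + x * y + x * y     ≈⟨ +-assoc _ _ _ ⟩
    x ² + y ² + (x * y + x * y)   ≈⟨ +-congˡ (x+x≈0 (x * y)) ⟩
    x ² + y ² + 0#                ≈⟨ +-identityʳ _ ⟩
    x ² + y ²                     ∎

  ²-injective : ∀ {x y} → x ² ≈ y ² → x ≈ y
  ²-injective {x} {y} x²≈y² with x*y≈0⇒x≈0⊎y≈0 (trans (²-+ x y) (x≈y⇒x+y≈0 x²≈y²))
  ... | inj₁ x+y≈0 = x+y≈0⇒x≈y x+y≈0
  ... | inj₂ x+y≈0 = x+y≈0⇒x≈y x+y≈0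

  frobenius : ℕ → A → A
  frobenius i x = pow x (2 ℕ.^ i)

  frobenius-suc : ∀ i x → frobenius (suc i) x ≈ frobenius i x ²
  frobenius-suc i x = begin
    pow x (2 ℕ.^ i ℕ.+ (2 ℕ.^ i ℕ.+ 0)) ≈⟨ reflexive (≡.cong (λ n → pow x (2 ℕ.^ i ℕ.+ n)) (ℕ.+-identityʳ (2 ℕ.^ i))) ⟩
    pow x (2 ℕ.^ i ℕ.+ 2 ℕ.^ i)         ≈⟨ pow-+ x (2 ℕ.^ i) (2 ℕ.^ i) ⟩
    frobenius i x ²                     ∎

  frobenius-cong : ∀ i {x y} → x ≈ y → frobenius i x ≈ frobenius i y
  frobenius-cong i = pow-cong (2 ℕ.^ i)

  frobenius-+ : ∀ i x y → frobenius i (x + y) ≈ frobenius i x + frobenius i y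
  frobenius-+ zero    x y = trans (*-identityʳ _) (+-cong (sym (*-identityʳ x)) (sym (*-identityʳ y)))
  frobenius-+ (suc i) x y = begin
    frobenius (suc i) (x + y)              ≈⟨ frobenius-suc i (x + y) ⟩
    frobenius i (x + y) ²                  ≈⟨ ²-cong (frobenius-+ i x y) ⟩
    (frobenius i x + frobenius i y) ²      ≈⟨ ²-+ _ _ ⟩
    frobenius i x ² + frobenius i y ²      ≈⟨ +-cong (frobenius-suc i x) (frobenius-suc i y) ⟨
    frobenius (suc i) x + frobenius (suc i) y ∎

  ∑< : ℕ → (ℕ → A) → A
  ∑< zero    g = 0#
  ∑< (suc n) g = g 0 + ∑< n (g ∘ suc)

  syntax ∑< n (λ i → e) = ∑[ i < n ] e

  ΣF-applyUpTo : ∀ (h : ℕ → ℕ) n (g : ℕ → A) → ΣF (applyUpTo h n) g ≡ ∑< n (g ∘ h)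
  ΣF-applyUpTo h zero    g = ≡.refl
  ΣF-applyUpTo h (suc n) g = ≡.cong (g (h 0) +_) (ΣF-applyUpTo (h ∘ suc) n g)

  ∑<-cong : ∀ n {g h : ℕ → A} → (∀ i → g i ≈ h i) → ∑< n g ≈ ∑< n h
  ∑<-cong zero    g≈h = refl
  ∑<-cong (suc n) g≈h = +-cong (g≈h 0) (∑<-cong n (g≈h ∘ suc))

  ∑<-suc : ∀ n (g : ℕ → A) → ∑< (suc n) g ≈ ∑< n g + g n
  ∑<-suc zero    g = trans (+-identityʳ _) (sym (+-identityˡ _))
  ∑<-suc (suc n) g = trans (+-congˡ (∑<-suc n (g ∘ suc))) (sym (+-assoc _ _ _))

  ∑<-+ : ∀ n (g h : ℕ → A) → ∑[ i < n ] (g i + h i) ≈ ∑< n g + ∑< n h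
  ∑<-+ zero    g h = sym (+-identityˡ 0#)
  ∑<-+ (suc n) g h = trans (+-congˡ (∑<-+ n (g ∘ suc) (h ∘ suc)))
    (solve 4 (λ a b c d → (a :+ b) :+ (c :+ d) := (a :+ c) :+ (b :+ d)) refl (g 0) (h 0) _ _)

  ∑<-² : ∀ n (g : ℕ → A) → ∑< n g ² ≈ ∑[ i < n ] (g i ²)
  ∑<-² zero    g = zeroˡ 0#
  ∑<-² (suc n) g = trans (²-+ _ _) (+-congˡ (∑<-² n (g ∘ suc)))

  tr≈∑frobenius : ∀ x → tr x ≈ ∑[ i < r ] frobenius i x
  tr≈∑frobenius x = reflexive (ΣF-applyUpTo (λ i → i) r (λ i → frobenius i x))

  tr-cong : ∀ {x y} → x ≈ y → tr x ≈ tr y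
  tr-cong {x} {y} x≈y = begin
    tr x                        ≈⟨ tr≈∑frobenius x ⟩
    ∑[ i < r ] frobenius i x    ≈⟨ ∑<-cong r (λ i → frobenius-cong i x≈y) ⟩
    ∑[ i < r ] frobenius i y    ≈⟨ tr≈∑frobenius y ⟨
    tr y                        ∎

  tr-+ : ∀ x y → tr (x + y) ≈ tr x + tr y
  tr-+ x y = begin
    tr (x + y)                                       ≈⟨ tr≈∑frobenius (x + y) ⟩
    ∑[ i < r ] frobenius i (x + y)                   ≈⟨ ∑<-cong r (λ i → frobenius-+ i x y) ⟩
    ∑[ i < r ] (frobenius i x + frobenius i y)       ≈⟨ ∑<-+ r _ _ ⟩
    (∑[ i < r ] frobenius i x) + (∑[ i < r ] frobenius i y)
                                                     ≈⟨ +-cong (tr≈∑frobenius x) (tr≈∑frobenius y) ⟨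
    tr x + tr y                                      ∎

  ∑frobenius-suc≈tr : ∀ x → ∑[ i < r ] frobenius (suc i) x ≈ tr x
  ∑frobenius-suc≈tr x = begin
    ∑< r (g ∘ suc)                  ≈⟨ +-identityˡ _ ⟨
    0# + ∑< r (g ∘ suc)             ≈⟨ +-congʳ (x+x≈0 x) ⟨
    (x + x) + ∑< r (g ∘ suc)        ≈⟨ +-assoc _ _ _ ⟩
    x + (x + ∑< r (g ∘ suc))        ≈⟨ +-congˡ (+-congʳ (*-identityʳ x)) ⟨
    x + ∑< (suc r) g                ≈⟨ +-congˡ (∑<-suc r g) ⟩
    x + (∑< r g + g r)              ≈⟨ +-congˡ (+-congˡ (fermat x)) ⟩
    x + (∑< r g + x)                ≈⟨ solve 2 (λ x t → x :+ (t :+ x) := t :+ (x :+ x)) refl x (∑< r g) ⟩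
    ∑< r g + (x + x)                ≈⟨ +-congˡ (x+x≈0 x) ⟩
    ∑< r g + 0#                     ≈⟨ +-identityʳ _ ⟩
    ∑< r g                          ≈⟨ tr≈∑frobenius x ⟨
    tr x                            ∎
    where
    g : ℕ → A
    g i = frobenius i x

  tr[x]²≈tr[x] : ∀ x → tr x ² ≈ tr x
  tr[x]²≈tr[x] x = begin
    tr x ²                           ≈⟨ ²-cong (tr≈∑frobenius x) ⟩
    (∑[ i < r ] frobenius i x) ²     ≈⟨ ∑<-² r _ ⟩
    ∑[ i < r ] (frobenius i x ²)     ≈⟨ ∑<-cong r (λ i → frobenius-suc i x) ⟨
    ∑[ i < r ] frobenius (suc i) x   ≈⟨ ∑frobenius-suc≈tr x ⟩
    tr x                             ∎

  tr[x²]≈tr[x] : ∀ x → tr (x ²) ≈ tr x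
  tr[x²]≈tr[x] x = begin
    tr (x ²)                         ≈⟨ tr≈∑frobenius (x ²) ⟩
    ∑[ i < r ] frobenius i (x ²)     ≈⟨ ∑<-cong r (λ i → pow-distrib-* x x (2 ℕ.^ i)) ⟩
    ∑[ i < r ] (frobenius i x ²)     ≈⟨ ∑<-cong r (λ i → frobenius-suc i x) ⟨
    ∑[ i < r ] frobenius (suc i) x   ≈⟨ ∑frobenius-suc≈tr x ⟩
    tr x                             ∎

  tr≈0⊎tr≈1 : ∀ x → tr x ≈ 0# ⊎ tr x ≈ 1#
  tr≈0⊎tr≈1 x with x*y≈0⇒x≈0⊎y≈0 t[t+1]≈0
    where
    t[t+1]≈0 : tr x * (tr x + 1#) ≈ 0#
    t[t+1]≈0 = trans (solve 1 (λ t → t :* (t :+ con 1) := t :* t :+ t) refl (tr x))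
                     (x≈y⇒x+y≈0 (tr[x]²≈tr[x] x))
  ... | inj₁ t≈0   = inj₁ t≈0
  ... | inj₂ t+1≈0 = inj₂ (x+y≈0⇒x≈y t+1≈0)

  λχ-tr≈0 : ∀ {x} → tr x ≈ 0# → λχ x ≡ 1ℤ
  λχ-tr≈0 {x} t≈0 with tr x ≟ 0#
  ... | yes _   = ≡.refl
  ... | no  t≉0 = contradiction t≈0 t≉0

  λχ-tr≈1 : ∀ {x} → tr x ≈ 1# → λχ x ≡ -1ℤ
  λχ-tr≈1 {x} t≈1 with tr x ≟ 0#
  ... | yes t≈0 = contradiction (trans (sym t≈1) t≈0) 1≉0
  ... | no  _   = ≡.refl

  λχ-cong : Congruent _≈_ _≡_ λχ
  λχ-cong {x} {y} x≈y with tr≈0⊎tr≈1 y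
  ... | inj₁ t≈0 = ≡.trans (λχ-tr≈0 (trans (tr-cong x≈y) t≈0)) (≡.sym (λχ-tr≈0 t≈0))
  ... | inj₂ t≈1 = ≡.trans (λχ-tr≈1 (trans (tr-cong x≈y) t≈1)) (≡.sym (λχ-tr≈1 t≈1))

  λχ-+ : ∀ x y → λχ (x + y) ≡ λχ x *ᶻ λχ y
  λχ-+ x y with tr≈0⊎tr≈1 x | tr≈0⊎tr≈1 y
  ... | inj₁ a | inj₁ b = ≡.trans (λχ-tr≈0 (trans (tr-+ x y) (trans (+-cong a b) (+-identityʳ 0#))))
                                  (≡.sym (≡.cong₂ _*ᶻ_ (λχ-tr≈0 a) (λχ-tr≈0 b)))
  ... | inj₁ a | inj₂ b = ≡.trans (λχ-tr≈1 (trans (tr-+ x y) (trans (+-cong a b) (+-identityˡ 1#))))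
                                  (≡.sym (≡.cong₂ _*ᶻ_ (λχ-tr≈0 a) (λχ-tr≈1 b)))
  ... | inj₂ a | inj₁ b = ≡.trans (λχ-tr≈1 (trans (tr-+ x y) (trans (+-cong a b) (+-identityʳ 1#))))
                                  (≡.sym (≡.cong₂ _*ᶻ_ (λχ-tr≈1 a) (λχ-tr≈0 b)))
  ... | inj₂ a | inj₂ b = ≡.trans (λχ-tr≈0 (trans (tr-+ x y) (trans (+-cong a b) (x+x≈0 1#))))
                                  (≡.sym (≡.cong₂ _*ᶻ_ (λχ-tr≈1 a) (λχ-tr≈1 b)))

  λχ-² : ∀ x → λχ (x ²) ≡ λχ x
  λχ-² x with tr≈0⊎tr≈1 x
  ... | inj₁ t≈0 = ≡.trans (λχ-tr≈0 (trans (tr[x²]≈tr[x] x) t≈0)) (≡.sym (λχ-tr≈0 t≈0))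
  ... | inj₂ t≈1 = ≡.trans (λχ-tr≈1 (trans (tr[x²]≈tr[x] x) t≈1)) (≡.sym (λχ-tr≈1 t≈1))

module Polynomial {c ℓ} {F : CommutativeRing c ℓ} {r : ℕ} (K : FiniteField2 F r) where
  open CommutativeRing F renaming (Carrier to A)
  open FF K using (pow)
  open FieldFacts K
  open CharacteristicTwo K using (x+y≈0⇒x≈y; x≈y⇒x+y≈0)
  open import Data.List.Relation.Unary.Unique.Setoid setoid using (Unique)
  open import Relation.Binary.Reasoning.Setoid setoid
  open import Algebra.Solver.Ring.NaturalCoefficients.Default commutativeSemiring

  -- horner (c₀ ∷ ⋯ ∷ cₙ₋₁) t x = c₀ + c₁ x + ⋯ + cₙ₋₁ xⁿ⁻¹ + t xⁿ, a polynomial of degree n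
  -- whose leading coefficient t is kept apart so that its degree is the length of the list.
  horner : List A → A → A → A
  horner []       t x = t
  horner (c ∷ cs) t x = c + x * horner cs t x

  quotient : A → List A → A → List A
  quotient α []       t = []
  quotient α (d ∷ ds) t = horner (d ∷ ds) t α ∷ quotient α ds t

  length-quotient : ∀ α cs t → length (quotient α cs t) ≡ length cs
  length-quotient α []       t = ≡.refl
  length-quotient α (d ∷ ds) t = ≡.cong suc (length-quotient α ds t)

  -- p(x) − p(α) = (x − α) q(x), with both sides moved so that no subtraction occurs.
  division : ∀ α x c cs t →
             horner (c ∷ cs) t x + α * horner (quotient α cs t) t x
               ≈ x * horner (quotient α cs t) t x + horner (c ∷ cs) t α
  division α x c []       t = solve 4 (λ c x t α → (c :+ x :* t) :+ α :* t := x :* t :+ (c :+ α :* t)) refl c x t α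
  division α x c (d ∷ ds) t = begin
    (c + x * p) + α * (v + x * q)  ≈⟨ solve 6 (λ c x p α v q → (c :+ x :* p) :+ α :* (v :+ x :* q) := (c :+ α :* v) :+ x :* (p :+ α :* q)) refl c x p α v q ⟩
    (c + α * v) + x * (p + α * q)  ≈⟨ +-congˡ (*-congˡ (division α x d ds t)) ⟩
    (c + α * v) + x * (x * q + v)  ≈⟨ solve 5 (λ c x α v q → (c :+ α :* v) :+ x :* (x :* q :+ v) := x :* (v :+ x :* q) :+ (c :+ α :* v)) refl c x α v q ⟩
    x * (v + x * q) + (c + α * v)  ∎
    where
    p v q : A
    p = horner (d ∷ ds) t x
    v = horner (d ∷ ds) t α
    q = horner (quotient α ds t) t x

  quotient-root : ∀ {α β} c cs t → horner (c ∷ cs) t α ≈ 0# → horner (c ∷ cs) t β ≈ 0# →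
                  α ≉ β → horner (quotient α cs t) t β ≈ 0#
  quotient-root {α} {β} c cs t pα≈0 pβ≈0 α≉β
    with x*y≈0⇒x≈0⊎y≈0 (trans (distribʳ q α β) (x≈y⇒x+y≈0 αq≈βq))
    where
    q : A
    q = horner (quotient α cs t) t β
    αq≈βq : α * q ≈ β * q
    αq≈βq = begin
      α * q                              ≈⟨ +-identityˡ _ ⟨
      0# + α * q                         ≈⟨ +-congʳ pβ≈0 ⟨
      horner (c ∷ cs) t β + α * q        ≈⟨ division α β c cs t ⟩
      β * q + horner (c ∷ cs) t α        ≈⟨ +-congˡ pα≈0 ⟩
      β * q + 0#                         ≈⟨ +-identityʳ _ ⟩
      β * q                              ∎
  ... | inj₁ α+β≈0 = contradiction (x+y≈0⇒x≈y α+β≈0) α≉β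
  ... | inj₂ q≈0   = q≈0

  roots≤degree : ∀ cs {t} → t ≉ 0# → ∀ {xs} → Unique xs → All (λ x → horner cs t x ≈ 0#) xs →
                 length xs ≤ length cs
  roots≤degree cs       t≉0 {[]}     _ _ = z≤n
  roots≤degree []       t≉0 {x ∷ xs} _ (t≈0 ∷ _) = contradiction t≈0 t≉0
  roots≤degree (c ∷ cs) {t} t≉0 {α ∷ xs} (α≉xs ∷ xs!) (pα≈0 ∷ pxs≈0) =
    s≤s (≡.subst (length xs ≤_) (length-quotient α cs t)
          (roots≤degree (quotient α cs t) t≉0 xs! (All.zipWith quotient-roots (α≉xs , pxs≈0))))
    where
    quotient-roots : ∀ {β} → α ≉ β × horner (c ∷ cs) t β ≈ 0# → horner (quotient α cs t) t β ≈ 0#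
    quotient-roots (α≉β , pβ≈0) = quotient-root c cs t pα≈0 pβ≈0 α≉β

  eval : List A → A → A
  eval cs = horner cs 0#

  horner≈eval+lead : ∀ cs t x → horner cs t x ≈ eval cs x + t * pow x (length cs)
  horner≈eval+lead []       t x = trans (sym (*-identityʳ t)) (sym (+-identityˡ _))
  horner≈eval+lead (c ∷ cs) t x = begin
    c + x * horner cs t x                         ≈⟨ +-congˡ (*-congˡ (horner≈eval+lead cs t x)) ⟩
    c + x * (eval cs x + t * pow x (length cs))   ≈⟨ solve 5 (λ c x e t p → c :+ x :* (e :+ t :* p) := (c :+ x :* e) :+ t :* (x :* p)) refl c x (eval cs x) t (pow x (length cs)) ⟩
    (c + x * eval cs x) + t * (x * pow x (length cs)) ∎

  eval-++ : ∀ cs ds x → eval (cs ++ ds) x ≈ eval cs x + pow x (length cs) * eval ds x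
  eval-++ []       ds x = sym (trans (+-identityˡ _) (*-identityˡ _))
  eval-++ (c ∷ cs) ds x = begin
    c + x * eval (cs ++ ds) x                                ≈⟨ +-congˡ (*-congˡ (eval-++ cs ds x)) ⟩
    c + x * (eval cs x + pow x (length cs) * eval ds x)      ≈⟨ solve 5 (λ c x e p q → c :+ x :* (e :+ p :* q) := (c :+ x :* e) :+ (x :* p) :* q) refl c x (eval cs x) (pow x (length cs)) (eval ds x) ⟩
    (c + x * eval cs x) + (x * pow x (length cs)) * eval ds x ∎

  eval-replicate-0 : ∀ n x → eval (replicate n 0#) x ≈ 0#
  eval-replicate-0 zero    x = refl
  eval-replicate-0 (suc n) x = trans (+-congˡ (trans (*-congˡ (eval-replicate-0 n x)) (zeroʳ x))) (+-identityʳ 0#)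

module SquareRoot {c ℓ} {F : CommutativeRing c ℓ} {r : ℕ} (K : FiniteField2 F r) (r≥1 : r ≥ 1) where
  open CommutativeRing F renaming (Carrier to A)
  open CharacteristicTwo K using (fermat)
  open AbsoluteTrace K using (_²; ²-cong; ²-injective; frobenius; frobenius-suc; frobenius-cong)

  √ : A → A
  √ = frobenius (ℕ.pred r)

  √-cong : ∀ {x y} → x ≈ y → √ x ≈ √ y
  √-cong = frobenius-cong (ℕ.pred r)

  √x²≈x : ∀ x → √ x ² ≈ x
  √x²≈x x = trans (sym (frobenius-suc (ℕ.pred r) x))
                  (trans (reflexive (≡.cong (λ n → frobenius n x) (ℕ.suc-pred r {{ℕ.>-nonZero r≥1}}))) (fermat x))

  x²≈y⇒x≈√y : ∀ {x y} → x ² ≈ y → x ≈ √ y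
  x²≈y⇒x≈√y {y = y} x²≈y = ²-injective (trans x²≈y (sym (√x²≈x y)))

  x≈√y⇒x²≈y : ∀ {x y} → x ≈ √ y → x ² ≈ y
  x≈√y⇒x²≈y {y = y} x≈√y = trans (²-cong x≈√y) (√x²≈x y)

module TraceOne {c ℓ} {F : CommutativeRing c ℓ} {r : ℕ} (K : FiniteField2 F r) (r≥1 : r ≥ 1) where
  open CommutativeRing F renaming (Carrier to A)
  open FiniteField2 K
  open FF K using (tr; pow)
  open AbsoluteTrace K
  open Polynomial K
  open import Relation.Binary.Reasoning.Setoid setoid

  tracePolynomial : ℕ → List A
  tracePolynomial zero    = 0# ∷ []
  tracePolynomial (suc k) = tracePolynomial k ++ 1# ∷ replicate (ℕ.pred (2 ℕ.^ k)) 0#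

  length-tracePolynomial : ∀ k → length (tracePolynomial k) ≡ 2 ℕ.^ k
  length-tracePolynomial zero    = ≡.refl
  length-tracePolynomial (suc k) = ≡.trans (List.length-++ (tracePolynomial k))
    (≡.trans (≡.cong₂ (λ m n → m ℕ.+ suc n) (length-tracePolynomial k) (List.length-replicate (ℕ.pred (2 ℕ.^ k))))
             (≡.cong (2 ℕ.^ k ℕ.+_) (≡.trans (ℕ.suc-pred (2 ℕ.^ k) {{ℕ.m^n≢0 2 k}}) (≡.sym (ℕ.+-identityʳ (2 ℕ.^ k))))))

  eval-tracePolynomial : ∀ k x → eval (tracePolynomial k) x ≈ ∑[ i < k ] frobenius i x
  eval-tracePolynomial zero    x = trans (+-congˡ (zeroʳ x)) (+-identityʳ 0#)
  eval-tracePolynomial (suc k) x = begin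
    eval (tracePolynomial k ++ 1# ∷ zeros) x                       ≈⟨ eval-++ (tracePolynomial k) _ x ⟩
    eval (tracePolynomial k) x + pow x (length (tracePolynomial k)) * (1# + x * eval zeros x)
      ≈⟨ +-cong (eval-tracePolynomial k x)
                (*-cong (reflexive (≡.cong (pow x) (length-tracePolynomial k)))
                        (trans (+-congˡ (trans (*-congˡ (eval-replicate-0 (ℕ.pred (2 ℕ.^ k)) x)) (zeroʳ x))) (+-identityʳ 1#))) ⟩
    ∑[ i < k ] frobenius i x + frobenius k x * 1#                 ≈⟨ +-congˡ (*-identityʳ _) ⟩
    ∑[ i < k ] frobenius i x + frobenius k x                      ≈⟨ ∑<-suc k (λ i → frobenius i x) ⟨
    ∑[ i < suc k ] frobenius i x                                  ∎
    where
    zeros : List A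
    zeros = replicate (ℕ.pred (2 ℕ.^ k)) 0#

  k : ℕ
  k = ℕ.pred r

  1+k≡r : suc k ≡ r
  1+k≡r = ℕ.suc-pred r {{ℕ.>-nonZero r≥1}}

  tr≈horner : ∀ x → tr x ≈ horner (tracePolynomial k) 1# x
  tr≈horner x = begin
    tr x                                                 ≈⟨ tr≈∑frobenius x ⟩
    ∑[ i < r ] frobenius i x                             ≈⟨ reflexive (≡.cong (λ n → ∑[ i < n ] frobenius i x) 1+k≡r) ⟨
    ∑[ i < suc k ] frobenius i x                         ≈⟨ ∑<-suc k (λ i → frobenius i x) ⟩
    ∑[ i < k ] frobenius i x + frobenius k x             ≈⟨ +-cong (eval-tracePolynomial k x)
                                                              (trans (*-identityˡ _) (reflexive (≡.cong (pow x) (length-tracePolynomial k)))) ⟨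
    eval p x + 1# * pow x (length p)                     ≈⟨ horner≈eval+lead p 1# x ⟨
    horner p 1# x                                        ∎
    where
    p : List A
    p = tracePolynomial k

  ∃tr≈1 : Σ[ y ∈ A ] tr y ≈ 1#
  ∃tr≈1 with any? (λ y → tr y ≟ 1#) elems
  ... | yes ∃tr≈1 = satisfied ∃tr≈1
  ... | no  ∄tr≈1 = contradiction (roots≤degree p 1≉0 unique every-element-is-root) q≰deg
    where
    p : List A
    p = tracePolynomial k
    every-element-is-root : All (λ x → horner p 1# x ≈ 0#) elems
    every-element-is-root = All.map (λ {x} tr≉1 → trans (sym (tr≈horner x)) (tr≉1⇒tr≈0 tr≉1))
                                    (¬Any⇒All¬ elems ∄tr≈1)
      where
      tr≉1⇒tr≈0 : ∀ {x} → ¬ tr x ≈ 1# → tr x ≈ 0#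
      tr≉1⇒tr≈0 {x} tr≉1 with tr≈0⊎tr≈1 x
      ... | inj₁ tr≈0 = tr≈0
      ... | inj₂ tr≈1 = contradiction tr≈1 tr≉1
    q≰deg : ¬ length elems ≤ length p
    q≰deg q≤deg = ℕ.<⇒≱ (ℕ.^-monoʳ-< 2 (s≤s (s≤s z≤n)) (ℕ.n<1+n k))
      (≡.subst₂ _≤_ (≡.trans card (≡.cong (2 ℕ.^_) (≡.sym 1+k≡r)))
                    (length-tracePolynomial k) q≤deg)

module CharacterSum {c ℓ} {F : CommutativeRing c ℓ} {r : ℕ} (K : FiniteField2 F r) (r≥1 : r ≥ 1) where
  open CommutativeRing F renaming (Carrier to A)
  open FiniteField2 K
  open FF K using (λχ)
  open IntegerSum
  open FieldSums K using (∑-affine)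
  open AbsoluteTrace K using (λχ-cong; λχ-+; λχ-tr≈1)
  open TraceOne K r≥1 using (∃tr≈1)
  open ≡.≡-Reasoning

  ∑λχ≡0 : ∑ elems λχ ≡ 0ℤ
  ∑λχ≡0 = s≡-s⇒s≡0 (begin
    ∑ elems λχ                              ≡⟨ ∑-affine λχ-cong y 1≉0 ⟨
    ∑ elems (λ x → λχ (1# * x + y))         ≡⟨ ∑-cong elems (λ x → ≡.trans (λχ-cong (+-congʳ (*-identityˡ x))) (λχ-+ x y)) ⟩
    ∑ elems (λ x → λχ x *ᶻ λχ y)            ≡⟨ ∑-*ʳ elems (λχ y) λχ ⟩
    ∑ elems λχ *ᶻ λχ y                      ≡⟨ ≡.cong (∑ elems λχ *ᶻ_) (λχ-tr≈1 (proj₂ ∃tr≈1)) ⟩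
    ∑ elems λχ *ᶻ -1ℤ                       ∎)
    where
    y : A
    y = proj₁ ∃tr≈1
    s≡-s⇒s≡0 : ∀ {s} → s ≡ s *ᶻ -1ℤ → s ≡ 0ℤ
    s≡-s⇒s≡0 {ℤ.+ zero}  _  = ≡.refl
    s≡-s⇒s≡0 {ℤ.+ suc n} ()
    s≡-s⇒s≡0 {ℤ.-[1+ n ]} ()

  ∑λχ-affine≡0 : ∀ {a} b → a ≉ 0# → ∑ elems (λ x → λχ (a * x + b)) ≡ 0ℤ
  ∑λχ-affine≡0 b a≉0 = ≡.trans (∑-affine λχ-cong b a≉0) ∑λχ≡0

module OrthogonalGroup {c ℓ} {F : CommutativeRing c ℓ} {r : ℕ} (K : FiniteField2 F r) (r≥1 : r ≥ 1) where
  open CommutativeRing F renaming (Carrier to A)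
  open FiniteField2 K
  open FF K using (Mat3; vecs; det; θ; _·_; inO3; i0; i1; i2)
  open CharacteristicTwo K using (x+x≈0; -x≈x; x+y≈0⇒x≈y)
  open AbsoluteTrace K using (_²; ²-injective)
  open SquareRoot K r≥1 using (√; x²≈y⇒x≈√y; x≈√y⇒x²≈y)
  open import Relation.Binary.Reasoning.Setoid setoid
  open import Algebra.Solver.Ring.NaturalCoefficients.Default commutativeSemiring
  open import Algebra.Properties.Group +-group using (quasigroup)
  open import Algebra.Properties.Quasigroup quasigroup using () renaming (cancelˡ to +-cancelˡ)

  module Entries (w : Mat3) where
    w₀₀ w₀₁ w₀₂ w₁₀ w₁₁ w₁₂ w₂₀ w₂₁ w₂₂ : A
    w₀₀ = w i0 i0
    w₀₁ = w i0 i1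
    w₀₂ = w i0 i2
    w₁₀ = w i1 i0
    w₁₁ = w i1 i1
    w₁₂ = w i1 i2
    w₂₀ = w i2 i0
    w₂₁ = w i2 i1
    w₂₂ = w i2 i2

    α₀ α₁ α₂ β₀₁ β₀₂ β₁₂ : A
    α₀  = w₀₀ * w₁₀ + w₂₀ ²
    α₁  = w₀₁ * w₁₁ + w₂₁ ²
    α₂  = w₀₂ * w₁₂ + w₂₂ ²
    β₀₁ = w₀₀ * w₁₁ + w₀₁ * w₁₀
    β₀₂ = w₀₀ * w₁₂ + w₀₂ * w₁₀
    β₁₂ = w₀₁ * w₁₂ + w₀₂ * w₁₁

  open Entries

  quadratic : A → A → A → A → A → A → A → A → A → A
  quadratic a₀ a₁ a₂ b₀₁ b₀₂ b₁₂ x y z = x ² * a₀ + y ² * a₁ + z ² * a₂ + (x * y) * b₀₁ + (x * z) * b₀₂ + (y * z) * b₁₂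

  θ∘ : Mat3 → A → A → A → A
  θ∘ w = quadratic (α₀ w) (α₁ w) (α₂ w) (β₀₁ w) (β₀₂ w) (β₁₂ w)

  x+[y+y]≈x : ∀ x y → x + (y + y) ≈ x
  x+[y+y]≈x x y = trans (+-congˡ (x+x≈0 y)) (+-identityʳ x)

  θ[w·v]≈θ∘ : ∀ w (v : Vector A 3) → θ (w · v) ≈ θ∘ w (v i0) (v i1) (v i2)
  θ[w·v]≈θ∘ w v = trans (solve 12 (λ a b c d e f g h i x y z →
      (a :* x :+ b :* y :+ c :* z) :* (d :* x :+ e :* y :+ f :* z) :+ (g :* x :+ h :* y :+ i :* z) :* (g :* x :+ h :* y :+ i :* z)
      := ((x :* x) :* (a :* d :+ g :* g) :+ (y :* y) :* (b :* e :+ h :* h) :+ (z :* z) :* (c :* f :+ i :* i)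
          :+ (x :* y) :* (a :* e :+ b :* d) :+ (x :* z) :* (a :* f :+ c :* d) :+ (y :* z) :* (b :* f :+ c :* e))
         :+ (((x :* y) :* (g :* h) :+ (x :* z) :* (g :* i) :+ (y :* z) :* (h :* i))
             :+ ((x :* y) :* (g :* h) :+ (x :* z) :* (g :* i) :+ (y :* z) :* (h :* i)))) refl
      (w₀₀ w) (w₀₁ w) (w₀₂ w) (w₁₀ w) (w₁₁ w) (w₁₂ w) (w₂₀ w) (w₂₁ w) (w₂₂ w) (v i0) (v i1) (v i2))
    (x+[y+y]≈x _ _)

  -- The paper's description of O(3,q): w = [[a′,b,0],[c,d,0],[g,h,1]] with g² = a′c, h² = bd
  -- and a′d + bc = 1; square roots being unique in characteristic 2, g and h are determined.
  Shape : Mat3 → Set ℓ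
  Shape w = w₀₂ w ≈ 0# × w₁₂ w ≈ 0# × w₂₀ w ≈ √ (w₀₀ w * w₁₀ w) × w₂₁ w ≈ √ (w₀₁ w * w₁₁ w)
          × w₂₂ w ≈ 1# × β₀₁ w ≈ 1#

  shape? : ∀ w → Dec (Shape w)
  shape? w = w₀₂ w ≟ 0# ×-dec w₁₂ w ≟ 0# ×-dec w₂₀ w ≟ √ (w₀₀ w * w₁₀ w) ×-dec w₂₁ w ≟ √ (w₀₁ w * w₁₁ w)
             ×-dec w₂₂ w ≟ 1# ×-dec β₀₁ w ≟ 1#

  shape⇒preserves-θ : ∀ w → Shape w → ∀ v → θ (w · v) ≈ θ v
  shape⇒preserves-θ w (w₀₂≈0 , w₁₂≈0 , w₂₀≈√ , w₂₁≈√ , w₂₂≈1 , β₀₁≈1) v = begin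
    θ (w · v)                                ≈⟨ θ[w·v]≈θ∘ w v ⟩
    θ∘ w x y z                               ≈⟨ +-cong (+-cong (+-cong (+-cong (+-cong (*-congˡ α₀≈0) (*-congˡ α₁≈0)) (*-congˡ α₂≈1)) (*-congˡ β₀₁≈1)) (*-congˡ β₀₂≈0)) (*-congˡ β₁₂≈0) ⟩
    quadratic 0# 0# 1# 1# 0# 0# x y z        ≈⟨ solve 3 (λ x y z → (x :* x) :* con 0 :+ (y :* y) :* con 0 :+ (z :* z) :* con 1 :+ (x :* y) :* con 1 :+ (x :* z) :* con 0 :+ (y :* z) :* con 0 := x :* y :+ z :* z) refl x y z ⟩
    θ v                                      ∎
    where
    x y z : A
    x = v i0
    y = v i1
    z = v i2
    α₀≈0 : α₀ w ≈ 0#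
    α₀≈0 = trans (+-congˡ (x≈√y⇒x²≈y w₂₀≈√)) (x+x≈0 _)
    α₁≈0 : α₁ w ≈ 0#
    α₁≈0 = trans (+-congˡ (x≈√y⇒x²≈y w₂₁≈√)) (x+x≈0 _)
    α₂≈1 : α₂ w ≈ 1#
    α₂≈1 = trans (+-cong (trans (*-congʳ w₀₂≈0) (zeroˡ _)) (*-cong w₂₂≈1 w₂₂≈1)) (trans (+-identityˡ _) (*-identityʳ 1#))
    β₀₂≈0 : β₀₂ w ≈ 0#
    β₀₂≈0 = trans (+-cong (trans (*-congˡ w₁₂≈0) (zeroʳ _)) (trans (*-congʳ w₀₂≈0) (zeroˡ _))) (+-identityʳ 0#)
    β₁₂≈0 : β₁₂ w ≈ 0#
    β₁₂≈0 = trans (+-cong (trans (*-congˡ w₁₂≈0) (zeroʳ _)) (trans (*-congʳ w₀₂≈0) (zeroˡ _))) (+-identityʳ 0#)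

  shape⇒det≈1 : ∀ w → Shape w → det w ≈ 1#
  shape⇒det≈1 w (w₀₂≈0 , w₁₂≈0 , _ , _ , w₂₂≈1 , β₀₁≈1) = begin
    det w
      ≈⟨ +-cong (+-cong (*-congˡ (+-congˡ (-x≈x _))) (trans (-x≈x _) (*-congˡ (+-congˡ (-x≈x _))))) (*-congˡ (+-congˡ (-x≈x _))) ⟩
    a * (e * i + f * h) + b * (d * i + f * g) + c′ * (d * h + e * g)
      ≈⟨ +-cong (+-cong (*-congˡ (+-cong (*-congˡ w₂₂≈1) (*-congʳ w₁₂≈0))) (*-congˡ (+-cong (*-congˡ w₂₂≈1) (*-congʳ w₁₂≈0)))) (*-congʳ w₀₂≈0) ⟩
    a * (e * 1# + 0# * h) + b * (d * 1# + 0# * g) + 0# * (d * h + e * g)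
      ≈⟨ solve 6 (λ a b d e g h → a :* (e :* con 1 :+ con 0 :* h) :+ b :* (d :* con 1 :+ con 0 :* g) :+ con 0 :* (d :* h :+ e :* g) := a :* e :+ b :* d) refl a b d e g h ⟩
    β₀₁ w
      ≈⟨ β₀₁≈1 ⟩
    1# ∎
    where
    a b c′ d e f g h i : A
    a = w₀₀ w; b = w₀₁ w; c′ = w₀₂ w; d = w₁₀ w; e = w₁₁ w; f = w₁₂ w; g = w₂₀ w; h = w₂₁ w; i = w₂₂ w

  quadraticᵖ : ∀ {n} → Polynomial n → Polynomial n → Polynomial n → Polynomial n → Polynomial n → Polynomial n →
               Polynomial n → Polynomial n → Polynomial n → Polynomial n
  quadraticᵖ a₀ a₁ a₂ b₀₁ b₀₂ b₁₂ x y z =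
    (x :* x) :* a₀ :+ (y :* y) :* a₁ :+ (z :* z) :* a₂ :+ (x :* y) :* b₀₁ :+ (x :* z) :* b₀₂ :+ (y :* z) :* b₁₂

  quadratic≈θ⇒coefficients : ∀ {a₀ a₁ a₂ b₀₁ b₀₂ b₁₂} →
    (∀ x y z → quadratic a₀ a₁ a₂ b₀₁ b₀₂ b₁₂ x y z ≈ x * y + z * z) →
    a₀ ≈ 0# × a₁ ≈ 0# × a₂ ≈ 1# × b₀₁ ≈ 1# × b₀₂ ≈ 0# × b₁₂ ≈ 0#
  quadratic≈θ⇒coefficients {a₀} {a₁} {a₂} {b₀₁} {b₀₂} {b₁₂} Q≈θ =
    a₀≈0 , a₁≈0 , a₂≈1 , b₀₁≈1 , b₀₂≈0 , b₁₂≈0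
    where
    a₀≈0 : a₀ ≈ 0#
    a₀≈0 = trans (solve 6 (λ a₀ a₁ a₂ b₀₁ b₀₂ b₁₂ → a₀ := quadraticᵖ a₀ a₁ a₂ b₀₁ b₀₂ b₁₂ (con 1) (con 0) (con 0)) refl a₀ a₁ a₂ b₀₁ b₀₂ b₁₂)
                 (trans (Q≈θ 1# 0# 0#) (solve 0 (con 1 :* con 0 :+ con 0 :* con 0 := con 0) refl))
    a₁≈0 : a₁ ≈ 0#
    a₁≈0 = trans (solve 6 (λ a₀ a₁ a₂ b₀₁ b₀₂ b₁₂ → a₁ := quadraticᵖ a₀ a₁ a₂ b₀₁ b₀₂ b₁₂ (con 0) (con 1) (con 0)) refl a₀ a₁ a₂ b₀₁ b₀₂ b₁₂)
                 (trans (Q≈θ 0# 1# 0#) (solve 0 (con 0 :* con 1 :+ con 0 :* con 0 := con 0) refl))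
    a₂≈1 : a₂ ≈ 1#
    a₂≈1 = trans (solve 6 (λ a₀ a₁ a₂ b₀₁ b₀₂ b₁₂ → a₂ := quadraticᵖ a₀ a₁ a₂ b₀₁ b₀₂ b₁₂ (con 0) (con 0) (con 1)) refl a₀ a₁ a₂ b₀₁ b₀₂ b₁₂)
                 (trans (Q≈θ 0# 0# 1#) (solve 0 (con 0 :* con 0 :+ con 1 :* con 1 := con 1) refl))
    b₀₁≈1 : b₀₁ ≈ 1#
    b₀₁≈1 = begin
      b₀₁                                       ≈⟨ +-identityˡ b₀₁ ⟨
      0# + b₀₁                                  ≈⟨ +-congʳ (trans (+-cong a₀≈0 a₁≈0) (+-identityˡ 0#)) ⟨
      (a₀ + a₁) + b₀₁                           ≈⟨ solve 6 (λ a₀ a₁ a₂ b₀₁ b₀₂ b₁₂ → (a₀ :+ a₁) :+ b₀₁ := quadraticᵖ a₀ a₁ a₂ b₀₁ b₀₂ b₁₂ (con 1) (con 1) (con 0)) refl a₀ a₁ a₂ b₀₁ b₀₂ b₁₂ ⟩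
      quadratic a₀ a₁ a₂ b₀₁ b₀₂ b₁₂ 1# 1# 0#   ≈⟨ Q≈θ 1# 1# 0# ⟩
      1# * 1# + 0# * 0#                         ≈⟨ solve 0 (con 1 :* con 1 :+ con 0 :* con 0 := con 1) refl ⟩
      1#                                        ∎
    b₀₂≈0 : b₀₂ ≈ 0#
    b₀₂≈0 = +-cancelˡ 1# b₀₂ 0# (begin
      1# + b₀₂                                  ≈⟨ +-congʳ (trans (+-cong a₀≈0 a₂≈1) (+-identityˡ 1#)) ⟨
      (a₀ + a₂) + b₀₂                           ≈⟨ solve 6 (λ a₀ a₁ a₂ b₀₁ b₀₂ b₁₂ → (a₀ :+ a₂) :+ b₀₂ := quadraticᵖ a₀ a₁ a₂ b₀₁ b₀₂ b₁₂ (con 1) (con 0) (con 1)) refl a₀ a₁ a₂ b₀₁ b₀₂ b₁₂ ⟩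
      quadratic a₀ a₁ a₂ b₀₁ b₀₂ b₁₂ 1# 0# 1#   ≈⟨ Q≈θ 1# 0# 1# ⟩
      1# * 0# + 1# * 1#                         ≈⟨ solve 0 (con 1 :* con 0 :+ con 1 :* con 1 := con 1 :+ con 0) refl ⟩
      1# + 0#                                   ∎)
    b₁₂≈0 : b₁₂ ≈ 0#
    b₁₂≈0 = +-cancelˡ 1# b₁₂ 0# (begin
      1# + b₁₂                                  ≈⟨ +-congʳ (trans (+-cong a₁≈0 a₂≈1) (+-identityˡ 1#)) ⟨
      (a₁ + a₂) + b₁₂                           ≈⟨ solve 6 (λ a₀ a₁ a₂ b₀₁ b₀₂ b₁₂ → (a₁ :+ a₂) :+ b₁₂ := quadraticᵖ a₀ a₁ a₂ b₀₁ b₀₂ b₁₂ (con 0) (con 1) (con 1)) refl a₀ a₁ a₂ b₀₁ b₀₂ b₁₂ ⟩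
      quadratic a₀ a₁ a₂ b₀₁ b₀₂ b₁₂ 0# 1# 1#   ≈⟨ Q≈θ 0# 1# 1# ⟩
      0# * 1# + 1# * 1#                         ≈⟨ solve 0 (con 0 :* con 1 :+ con 1 :* con 1 := con 1 :+ con 0) refl ⟩
      1# + 0#                                   ∎)

  coefficients⇒shape : ∀ w → α₀ w ≈ 0# × α₁ w ≈ 0# × α₂ w ≈ 1# × β₀₁ w ≈ 1# × β₀₂ w ≈ 0# × β₁₂ w ≈ 0# → Shape w
  coefficients⇒shape w (α₀≈0 , α₁≈0 , α₂≈1 , β₀₁≈1 , β₀₂≈0 , β₁₂≈0) =
    w₀₂≈0 , w₁₂≈0 , x²≈y⇒x≈√y (sym (x+y≈0⇒x≈y α₀≈0)) , x²≈y⇒x≈√y (sym (x+y≈0⇒x≈y α₁≈0)) , w₂₂≈1 , β₀₁≈1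
    where
    a b c′ d e f : A
    a = w₀₀ w; b = w₀₁ w; c′ = w₀₂ w; d = w₁₀ w; e = w₁₁ w; f = w₁₂ w
    w₁₂≈0 : f ≈ 0#
    w₁₂≈0 = begin
      f                              ≈⟨ *-identityʳ f ⟨
      f * 1#                         ≈⟨ *-congˡ β₀₁≈1 ⟨
      f * β₀₁ w                      ≈⟨ x+[y+y]≈x _ (c′ * (d * e)) ⟨
      f * β₀₁ w + (c′ * (d * e) + c′ * (d * e))
        ≈⟨ solve 6 (λ a b c′ d e f → f :* (a :* e :+ b :* d) :+ (c′ :* (d :* e) :+ c′ :* (d :* e)) := e :* (a :* f :+ c′ :* d) :+ d :* (b :* f :+ c′ :* e)) refl a b c′ d e f ⟩
      e * β₀₂ w + d * β₁₂ w          ≈⟨ +-cong (trans (*-congˡ β₀₂≈0) (zeroʳ e)) (trans (*-congˡ β₁₂≈0) (zeroʳ d)) ⟩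
      0# + 0#                        ≈⟨ +-identityʳ 0# ⟩
      0#                             ∎
    w₀₂≈0 : c′ ≈ 0#
    w₀₂≈0 = begin
      c′                             ≈⟨ *-identityʳ c′ ⟨
      c′ * 1#                        ≈⟨ *-congˡ β₀₁≈1 ⟨
      c′ * β₀₁ w                     ≈⟨ x+[y+y]≈x _ (a * (b * f)) ⟨
      c′ * β₀₁ w + (a * (b * f) + a * (b * f))
        ≈⟨ solve 6 (λ a b c′ d e f → c′ :* (a :* e :+ b :* d) :+ (a :* (b :* f) :+ a :* (b :* f)) := a :* (b :* f :+ c′ :* e) :+ b :* (a :* f :+ c′ :* d)) refl a b c′ d e f ⟩
      a * β₁₂ w + b * β₀₂ w          ≈⟨ +-cong (trans (*-congˡ β₁₂≈0) (zeroʳ a)) (trans (*-congˡ β₀₂≈0) (zeroʳ b)) ⟩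
      0# + 0#                        ≈⟨ +-identityʳ 0# ⟩
      0#                             ∎
    w₂₂≈1 : w₂₂ w ≈ 1#
    w₂₂≈1 = ²-injective (begin
      w₂₂ w ²                        ≈⟨ +-identityˡ _ ⟨
      0# + w₂₂ w ²                   ≈⟨ +-congʳ (trans (*-congʳ w₀₂≈0) (zeroˡ f)) ⟨
      α₂ w                           ≈⟨ α₂≈1 ⟩
      1#                             ≈⟨ *-identityʳ 1# ⟨
      1# ²                           ∎)

  All-vecs : ∀ n {p} {P : Vector A n → Set p} → All P (vecs n) →
             ∀ (v : Vector A n) → Σ[ v′ ∈ Vector A n ] (∀ i → v i ≈ v′ i) × P v′
  All-vecs zero    (pv ∷ []) v = []ᵥ , (λ ()) , pv
  All-vecs (suc n) {P = P} all v = x′ ∷ᵥ v′ , pointwise , pv′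
    where
    x′ : A
    x′ = Any.lookup (complete (v fzero))
    tail-all : All (P ∘ (x′ ∷ᵥ_)) (vecs n)
    tail-all = map⁻ (proj₁ (lookupAny (map⁻ (concat⁻ all)) (complete (v fzero))))
    rest : Σ[ v′ ∈ Vector A n ] (∀ i → v (fsuc i) ≈ v′ i) × P (x′ ∷ᵥ v′)
    rest = All-vecs n tail-all (v ∘ fsuc)
    v′ : Vector A n
    v′ = proj₁ rest
    pv′ : P (x′ ∷ᵥ v′)
    pv′ = proj₂ (proj₂ rest)
    pointwise : ∀ i → v i ≈ (x′ ∷ᵥ v′) i
    pointwise fzero    = proj₂ (lookupAny (map⁻ (concat⁻ all)) (complete (v fzero)))
    pointwise (fsuc i) = proj₁ (proj₂ rest) i

  ·-cong : ∀ w {u v : Vector A 3} → (∀ i → u i ≈ v i) → ∀ i → (w · u) i ≈ (w · v) i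
  ·-cong w u≈v i = +-cong (+-cong (*-congˡ (u≈v i0)) (*-congˡ (u≈v i1))) (*-congˡ (u≈v i2))

  θ-cong : ∀ {u v : Vector A 3} → (∀ i → u i ≈ v i) → θ u ≈ θ v
  θ-cong u≈v = +-cong (*-cong (u≈v i0) (u≈v i1)) (*-cong (u≈v i2) (u≈v i2))

  T⇔⇒≡does : ∀ {p} {P : Set p} {b} (p? : Dec P) → (T b → P) → (P → T b) → b ≡ does p?
  T⇔⇒≡does {b = false} (yes p) _   p⇒b = contradiction (p⇒b p) λ ()
  T⇔⇒≡does {b = false} (no  _) _   _   = ≡.refl
  T⇔⇒≡does {b = true}  (yes _) _   _   = ≡.refl
  T⇔⇒≡does {b = true}  (no ¬p) b⇒p _   = contradiction (b⇒p _) ¬p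

  preserves-θ? : Mat3 → Vector A 3 → Bool
  preserves-θ? w v = ⌊ θ (w · v) ≟ θ v ⌋

  T-foldr-∧⁺ : ∀ {a} {X : Set a} (g : X → Bool) xs → T (foldr (λ x b → g x ∧ b) true xs) → All (T ∘ g) xs
  T-foldr-∧⁺ g []       _ = []
  T-foldr-∧⁺ g (x ∷ xs) t with gx , rest ← Equivalence.to T-∧ t = gx ∷ T-foldr-∧⁺ g xs rest

  T-foldr-∧⁻ : ∀ {a} {X : Set a} {g : X → Bool} {xs} → All (T ∘ g) xs → T (foldr (λ x b → g x ∧ b) true xs)
  T-foldr-∧⁻ []         = _
  T-foldr-∧⁻ (gx ∷ gxs) = Equivalence.from T-∧ (gx , T-foldr-∧⁻ gxs)

  inO3⇒shape : ∀ w → T (inO3 w) → Shape w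
  inO3⇒shape w w∈O3 = coefficients⇒shape w (quadratic≈θ⇒coefficients θ∘≈θ)
    where
    preserves : All (T ∘ preserves-θ? w) (vecs 3)
    preserves = T-foldr-∧⁺ (preserves-θ? w) (vecs 3) (proj₂ (Equivalence.to T-∧ w∈O3))
    θ∘≈θ : ∀ x y z → θ∘ w x y z ≈ x * y + z * z
    θ∘≈θ x y z with v′ , v≈v′ , pv′ ← All-vecs 3 preserves (x ∷ᵥ y ∷ᵥ z ∷ᵥ []ᵥ) = begin
      θ∘ w x y z                ≈⟨ θ[w·v]≈θ∘ w v ⟨
      θ (w · v)                 ≈⟨ θ-cong (·-cong w v≈v′) ⟩
      θ (w · v′)                ≈⟨ toWitness pv′ ⟩
      θ v′                      ≈⟨ θ-cong v≈v′ ⟨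
      θ v                       ∎
      where
      v : Vector A 3
      v = x ∷ᵥ y ∷ᵥ z ∷ᵥ []ᵥ

  shape⇒inO3 : ∀ w → Shape w → T (inO3 w)
  shape⇒inO3 w shape = Equivalence.from T-∧
    ( fromWitness (λ det≈0 → 1≉0 (trans (sym (shape⇒det≈1 w shape)) det≈0))
    , T-foldr-∧⁻ (All.universal (λ v → fromWitness (shape⇒preserves-θ w shape v)) (vecs 3)))

  inO3≡shape? : ∀ w → inO3 w ≡ does (shape? w)
  inO3≡shape? w = T⇔⇒≡does (shape? w) (inO3⇒shape w) (shape⇒inO3 w)

module KloostermanIdentity {c ℓ} {F : CommutativeRing c ℓ} {r : ℕ} (K : FiniteField2 F r) (r≥1 : r ≥ 1) where
  open CommutativeRing F renaming (Carrier to A)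
  open FiniteField2 K
  open FieldFacts K
  open AbsoluteTrace K using (_²; ²-+)
  open SquareRoot K r≥1
  open import Relation.Binary.Reasoning.Setoid setoid
  open import Algebra.Solver.Ring.NaturalCoefficients.Default commutativeSemiring

  √[ux]≈0⇒x≈0 : ∀ {u x} → u ≉ 0# → √ (u * x) ≈ 0# → x ≈ 0#
  √[ux]≈0⇒x≈0 {u} {x} u≉0 √ux≈0 with x*y≈0⇒x≈0⊎y≈0 (trans (sym (√x²≈x (u * x))) (trans (*-congʳ √ux≈0) (zeroˡ _)))
  ... | inj₁ u≈0 = contradiction u≈0 u≉0
  ... | inj₂ x≈0 = x≈0

  x≈0⇒√[ux]≈0 : ∀ {u x} → x ≈ 0# → √ (u * x) ≈ 0#
  x≈0⇒√[ux]≈0 {u} {x} x≈0 with x*y≈0⇒x≈0⊎y≈0 (trans (√x²≈x (u * x)) (trans (*-congˡ x≈0) (zeroʳ u)))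
  ... | inj₁ √ux≈0 = √ux≈0
  ... | inj₂ √ux≈0 = √ux≈0

  [β+uβ⁻¹]²≈ux+ux⁻¹ : ∀ {u x} → u ≉ 0# → x ≉ 0# →
                      (√ (u * x) + u * √ (u * x) ⁻¹) ² ≈ u * x + u * x ⁻¹
  [β+uβ⁻¹]²≈ux+ux⁻¹ {u} {x} u≉0 x≉0 = trans (²-+ β (u * β ⁻¹)) (+-cong (√x²≈x (u * x)) [uβ⁻¹]²≈ux⁻¹)
    where
    β : A
    β = √ (u * x)
    [uβ⁻¹]²≈ux⁻¹ : (u * β ⁻¹) ² ≈ u * x ⁻¹
    [uβ⁻¹]²≈ux⁻¹ = *-cancelˡ (x*y≉0 u≉0 x≉0) (begin
      (u * x) * (u * β ⁻¹) ²       ≈⟨ *-congʳ (√x²≈x (u * x)) ⟨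
      β ² * (u * β ⁻¹) ²           ≈⟨ solve 3 (λ β u β⁻¹ → (β :* β) :* ((u :* β⁻¹) :* (u :* β⁻¹)) := (u :* u) :* ((β :* β⁻¹) :* (β :* β⁻¹))) refl β u (β ⁻¹) ⟩
      u ² * (β * β ⁻¹) ²           ≈⟨ *-congˡ (trans (*-cong ββ⁻¹≈1 ββ⁻¹≈1) (*-identityʳ 1#)) ⟩
      u ² * 1#                     ≈⟨ *-congˡ (⁻¹-inverse x x≉0) ⟨
      u ² * (x * x ⁻¹)             ≈⟨ solve 3 (λ u x x⁻¹ → (u :* u) :* (x :* x⁻¹) := (u :* x) :* (u :* x⁻¹)) refl u x (x ⁻¹) ⟩
      (u * x) * (u * x ⁻¹)         ∎)
      where
      ββ⁻¹≈1 : β * β ⁻¹ ≈ 1#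
      ββ⁻¹≈1 = ⁻¹-inverse β (x≉0 ∘ √[ux]≈0⇒x≈0 u≉0)

module TraceSum {c ℓ} {F : CommutativeRing c ℓ} {r : ℕ} (K : FiniteField2 F r) (r≥1 : r ≥ 1)
                (u : CommutativeRing.Carrier F) (u≉0 : ¬ CommutativeRing._≈_ F u (CommutativeRing.0# F)) where
  open CommutativeRing F renaming (Carrier to A)
  open FiniteField2 K
  open FF K using (elems*; Kl; λχ; Mat3; mats; vecs; Tr; inO3; O3; qℤ; i0; i1; i2)
  open IntegerSum
  open FieldFacts K
  open FieldSums K
  open CharacteristicTwo K using (x+y≈z⇒y≈x+z; y≈x+z⇒x+y≈z)
  open AbsoluteTrace K using (λχ-cong; λχ-+; λχ-²)
  open SquareRoot K r≥1
  open CharacterSum K r≥1 using (∑λχ-affine≡0)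
  open OrthogonalGroup K r≥1 using (shape?; inO3≡shape?; module Entries)
  open KloostermanIdentity K r≥1
  open ≡.≡-Reasoning
  open import Algebra.Solver.Ring.NaturalCoefficients.Default commutativeSemiring using (solve; _:=_; _:+_; _:*_; con)

  |F*| : ℤ
  |F*| = ℤ.+ length elems*

  ∑*λχ[ux+ux⁻¹]≡Kl : ∑ elems* (λ x → λχ (u * x + u * x ⁻¹)) ≡ Kl u
  ∑*λχ[ux+ux⁻¹]≡Kl = begin
    ∑ elems* (λ x → λχ (u * x + u * x ⁻¹))              ≡⟨ ∑-elems* _ ⟩
    ∑ elems (λ x → 𝟙≉0 x *ᶻ λχ (u * x + u * x ⁻¹))     ≡⟨ ∑-cong elems g∘√u·≡ ⟨
    ∑ elems (g ∘ √u·)                                   ≡⟨ ∑-reindex (𝟙≉0-*-cong λχ[β+uβ⁻¹]-cong) (√-cong ∘ *-congˡ) √u·-injective √u·-onto ⟩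
    ∑ elems g                                           ≡⟨ ∑-elems* _ ⟨
    Kl u                                                ∎
    where
    g : A → ℤ
    g β = 𝟙≉0 β *ᶻ λχ (β + u * β ⁻¹)
    √u· : A → A
    √u· x = √ (u * x)
    λχ[β+uβ⁻¹]-cong : ∀ {β β′} → β ≈ β′ → β ≉ 0# → λχ (β + u * β ⁻¹) ≡ λχ (β′ + u * β′ ⁻¹)
    λχ[β+uβ⁻¹]-cong β≈β′ β≉0 = λχ-cong (+-cong β≈β′ (*-congˡ (⁻¹-cong β≈β′ β≉0)))
    √u·-injective : ∀ {x y} → √u· x ≈ √u· y → x ≈ y
    √u·-injective {x} eq = *-cancelˡ u≉0 (trans (sym (√x²≈x (u * x))) (x≈√y⇒x²≈y eq))
    √u·-onto : ∀ y → Σ[ x ∈ A ] y ≈ √u· x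
    √u·-onto y = u ⁻¹ * (y * y) , x²≈y⇒x≈√y (sym (x*[x⁻¹*y]≈y (y * y) u≉0))
    g∘√u·≡ : ∀ x → g (√u· x) ≡ 𝟙≉0 x *ᶻ λχ (u * x + u * x ⁻¹)
    g∘√u·≡ x = ≡.trans (≡.cong (_*ᶻ λχ (√u· x + u * √u· x ⁻¹)) (𝟙≉0-iff (√[ux]≈0⇒x≈0 u≉0) x≈0⇒√[ux]≈0))
                       (𝟙-does-*-cong (nonzero? x) λ x≉0 →
                          ≡.trans (≡.sym (λχ-² _)) (λχ-cong ([β+uβ⁻¹]²≈ux+ux⁻¹ u≉0 x≉0)))

  ∑-vecs3 : ∀ (Φ : A → A → A → ℤ) →
            ∑ (vecs 3) (λ v → Φ (v i0) (v i1) (v i2)) ≡ ∑ elems λ x → ∑ elems λ y → ∑ elems λ z → Φ x y z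
  ∑-vecs3 Φ =
    ≡.trans (∑-concatMap (λ x → map (x ∷ᵥ_) (vecs 2)) elems (λ v → Φ (v i0) (v i1) (v i2))) (∑-cong elems λ x →
    ≡.trans (∑-map (x ∷ᵥ_) (vecs 2) (λ v → Φ (v i0) (v i1) (v i2)))
    (≡.trans (∑-concatMap (λ y → map (y ∷ᵥ_) (vecs 1)) elems (λ v → Φ x (v fzero) (v (fsuc fzero)))) (∑-cong elems λ y →
    ≡.trans (∑-map (y ∷ᵥ_) (vecs 1) (λ v → Φ x (v fzero) (v (fsuc fzero))))
    (≡.trans (∑-concatMap (λ z → map (z ∷ᵥ_) (vecs 0)) elems (λ v → Φ x y (v fzero))) (∑-cong elems λ z →
    ℤ.+-identityʳ (Φ x y z))))))

  Entrywise : Set c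
  Entrywise = A → A → A → A → A → A → A → A → A → ℤ

  entrywise : Entrywise → Mat3 → ℤ
  entrywise Γ w = Γ (w i0 i0) (w i0 i1) (w i0 i2) (w i1 i0) (w i1 i1) (w i1 i2) (w i2 i0) (w i2 i1) (w i2 i2)

  ∑⁹ : Entrywise → ℤ
  ∑⁹ Γ = ∑ elems λ a → ∑ elems λ b → ∑ elems λ c → ∑ elems λ d → ∑ elems λ e → ∑ elems λ f →
         ∑ elems λ g → ∑ elems λ h → ∑ elems λ i → Γ a b c d e f g h i

  ∑-mats : ∀ Γ → ∑ mats (entrywise Γ) ≡ ∑⁹ Γ
  ∑-mats Γ =
    ≡.trans (∑-concatMap _ (vecs 3) (entrywise Γ)) (≡.trans (∑-cong (vecs 3) λ r₀ →
      ≡.trans (∑-concatMap _ (vecs 3) (entrywise Γ)) (≡.trans (∑-cong (vecs 3) λ r₁ →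
        ≡.trans (∑-map _ (vecs 3) (entrywise Γ))
                (∑-vecs3 (Γ (r₀ i0) (r₀ i1) (r₀ i2) (r₁ i0) (r₁ i1) (r₁ i2))))
      (∑-vecs3 λ d e f → ∑ elems λ g → ∑ elems λ h → ∑ elems λ i → Γ (r₀ i0) (r₀ i1) (r₀ i2) d e f g h i)))
    (∑-vecs3 λ a b c → ∑ elems λ d → ∑ elems λ e → ∑ elems λ f → ∑ elems λ g → ∑ elems λ h → ∑ elems λ i → Γ a b c d e f g h i))

  L : A → A → ℤ
  L a e = λχ (u * (a + e + 1#))

  N : A → A → A → A → ℤ
  N a b d e = δ (a * e + b * d) 1# *ᶻ L a e

  Γ : Entrywise
  Γ a b c d e f g h i = ((((N a b d e *ᶻ δ c 0#) *ᶻ δ f 0#) *ᶻ δ g (√ (a * d))) *ᶻ δ h (√ (b * e))) *ᶻ δ i 1#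

  open Entries

  𝟙-shape : ∀ w → 𝟙 (does (shape? w)) *ᶻ L (w₀₀ w) (w₁₁ w) ≡ entrywise Γ w
  𝟙-shape w = begin
    𝟙 (does (shape? w)) *ᶻ L a e
      ≡⟨ ≡.cong (_*ᶻ L a e) 𝟙-split ⟩
    (δ c′ 0# *ᶻ (δ f 0# *ᶻ (δ g (√ (a * d)) *ᶻ (δ h (√ (b * e)) *ᶻ (δ i 1# *ᶻ δ (a * e + b * d) 1#))))) *ᶻ L a e
      ≡⟨ reassociate (δ c′ 0#) (δ f 0#) (δ g (√ (a * d))) (δ h (√ (b * e))) (δ i 1#) (δ (a * e + b * d) 1#) (L a e) ⟩
    entrywise Γ w
      ∎
    where
    a b c′ d e f g h i : A
    a = w₀₀ w; b = w₀₁ w; c′ = w₀₂ w; d = w₁₀ w; e = w₁₁ w; f = w₁₂ w; g = w₂₀ w; h = w₂₁ w; i = w₂₂ w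
    𝟙-split : 𝟙 (does (shape? w)) ≡ δ c′ 0# *ᶻ (δ f 0# *ᶻ (δ g (√ (a * d)) *ᶻ (δ h (√ (b * e)) *ᶻ (δ i 1# *ᶻ δ (a * e + b * d) 1#))))
    𝟙-split =
      ≡.trans (𝟙-∧ (does (c′ ≟ 0#)) _) (≡.cong (δ c′ 0# *ᶻ_) (
      ≡.trans (𝟙-∧ (does (f ≟ 0#)) _) (≡.cong (δ f 0# *ᶻ_) (
      ≡.trans (𝟙-∧ (does (g ≟ √ (a * d))) _) (≡.cong (δ g (√ (a * d)) *ᶻ_) (
      ≡.trans (𝟙-∧ (does (h ≟ √ (b * e))) _) (≡.cong (δ h (√ (b * e)) *ᶻ_) (
      𝟙-∧ (does (i ≟ 1#)) (does ((a * e + b * d) ≟ 1#))))))))))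
    reassociate : ∀ c f g h i n l → (c *ᶻ (f *ᶻ (g *ᶻ (h *ᶻ (i *ᶻ n))))) *ᶻ l ≡ ((((n *ᶻ l) *ᶻ c) *ᶻ f) *ᶻ g *ᶻ h) *ᶻ i
    reassociate = solve-∀

  ∑O3≡∑⁹ : ∑ O3 (λ w → λχ (u * Tr w)) ≡ ∑⁹ Γ
  ∑O3≡∑⁹ = begin
    ∑ O3 (λ w → λχ (u * Tr w))
      ≡⟨ ∑-filter (λ w → T? (inO3 w)) mats _ ⟩
    ∑ mats (λ w → if inO3 w then λχ (u * Tr w) else 0ℤ)
      ≡⟨ ∑-cong mats indicator ⟩
    ∑ mats (λ w → 𝟙 (does (shape? w)) *ᶻ λχ (u * Tr w))
      ≡⟨ ∑-cong mats Tr≡ ⟩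
    ∑ mats (λ w → 𝟙 (does (shape? w)) *ᶻ L (w₀₀ w) (w₁₁ w))
      ≡⟨ ∑-cong mats 𝟙-shape ⟩
    ∑ mats (entrywise Γ)
      ≡⟨ ∑-mats Γ ⟩
    ∑⁹ Γ
      ∎
    where
    indicator : ∀ w → (if inO3 w then λχ (u * Tr w) else 0ℤ) ≡ 𝟙 (does (shape? w)) *ᶻ λχ (u * Tr w)
    indicator w = ≡.trans (𝟙-* (inO3 w) (λχ (u * Tr w))) (≡.cong (λ b → 𝟙 b *ᶻ λχ (u * Tr w)) (inO3≡shape? w))
    Tr≡ : ∀ w → 𝟙 (does (shape? w)) *ᶻ λχ (u * Tr w) ≡ 𝟙 (does (shape? w)) *ᶻ L (w₀₀ w) (w₁₁ w)
    Tr≡ w = 𝟙-does-*-cong (shape? w) λ (_ , _ , _ , _ , w₂₂≈1 , _) → λχ-cong (*-congˡ (+-congˡ w₂₂≈1))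

  ∑⁹Γ≡∑⁴N : ∑⁹ Γ ≡ ∑ elems λ a → ∑ elems λ b → ∑ elems λ d → ∑ elems λ e → N a b d e
  ∑⁹Γ≡∑⁴N = ∑-cong elems λ a → ∑-cong elems λ b → begin
    (∑ elems λ c → ∑ elems λ d → ∑ elems λ e → ∑ elems λ f → ∑ elems λ g → ∑ elems λ h → ∑ elems λ i → Γ a b c d e f g h i)
      ≡⟨ ∑-cong elems (λ c → ∑-cong elems λ d → ∑-cong elems λ e → collapse-fghi a b c d e) ⟩
    (∑ elems λ c → ∑ elems λ d → ∑ elems λ e → N a b d e *ᶻ δ c 0#)
      ≡⟨ ∑-cong elems (λ c → ≡.trans (∑-cong elems λ d → ∑-*ʳ elems (δ c 0#) (N a b d)) (∑-*ʳ elems (δ c 0#) (λ d → ∑ elems (N a b d)))) ⟩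
    (∑ elems λ c → (∑ elems λ d → ∑ elems λ e → N a b d e) *ᶻ δ c 0#)
      ≡⟨ ∑-*-δ (∑ elems λ d → ∑ elems λ e → N a b d e) 0# ⟩
    (∑ elems λ d → ∑ elems λ e → N a b d e)
      ∎
    where
    collapse-fghi : ∀ a b c d e → (∑ elems λ f → ∑ elems λ g → ∑ elems λ h → ∑ elems λ i → Γ a b c d e f g h i)
                              ≡ N a b d e *ᶻ δ c 0#
    collapse-fghi a b c d e =
      ≡.trans (∑-cong elems λ f → ≡.trans (∑-cong elems λ g → ≡.trans (∑-cong elems λ h →
        ∑-*-δ (Γ₄ f g h) 1#) (∑-*-δ (Γ₃ f g) (√ (b * e)))) (∑-*-δ (Γ₂ f) (√ (a * d)))) (∑-*-δ Γ₁ 0#)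
      where
      Γ₁ : ℤ
      Γ₁ = N a b d e *ᶻ δ c 0#
      Γ₂ : A → ℤ
      Γ₂ f = Γ₁ *ᶻ δ f 0#
      Γ₃ : A → A → ℤ
      Γ₃ f g = Γ₂ f *ᶻ δ g (√ (a * d))
      Γ₄ : A → A → A → ℤ
      Γ₄ f g h = Γ₃ f g *ᶻ δ h (√ (b * e))

  ∑δ[k+bd≈1] : ∀ k b → ∑ elems (λ d → δ (k + b * d) 1#) ≡ δ b 0# *ᶻ (qℤ *ᶻ δ k 1#) +ᶻ 𝟙≉0 b
  ∑δ[k+bd≈1] k b with b ≟ 0#
  ... | yes b≈0 = begin
    ∑ elems (λ d → δ (k + b * d) 1#)   ≡⟨ ∑-cong elems (λ d → δ-cong (k+bd≈k d) refl) ⟩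
    ∑ elems (λ _ → δ k 1#)             ≡⟨ ∑-const elems (δ k 1#) ⟩
    ℤ.+ length elems *ᶻ δ k 1#         ≡⟨ ≡.cong (λ n → ℤ.+ n *ᶻ δ k 1#) card ⟩
    qℤ *ᶻ δ k 1#                       ≡⟨ ℤ.*-identityˡ _ ⟨
    1ℤ *ᶻ (qℤ *ᶻ δ k 1#)               ≡⟨ ℤ.+-identityʳ _ ⟨
    1ℤ *ᶻ (qℤ *ᶻ δ k 1#) +ᶻ 0ℤ         ∎
    where
    k+bd≈k : ∀ d → k + b * d ≈ k
    k+bd≈k d = trans (+-congˡ (trans (*-congʳ b≈0) (zeroˡ d))) (+-identityʳ k)
  ... | no  b≉0 = begin
    ∑ elems (λ d → δ (k + b * d) 1#)   ≡⟨ ∑-cong elems (λ d → δ-iff (solution d) (solution⁻¹ d)) ⟩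
    ∑ elems (λ d → δ d v)              ≡⟨ ∑-δ v ⟩
    1ℤ                                 ≡⟨ ≡.cong (_+ᶻ 1ℤ) (ℤ.*-zeroˡ (qℤ *ᶻ δ k 1#)) ⟨
    0ℤ *ᶻ (qℤ *ᶻ δ k 1#) +ᶻ 1ℤ         ∎
    where
    v : A
    v = b ⁻¹ * (k + 1#)
    solution : ∀ d → k + b * d ≈ 1# → d ≈ v
    solution d k+bd≈1 = *-cancelˡ b≉0 (trans (x+y≈z⇒y≈x+z k+bd≈1) (sym (x*[x⁻¹*y]≈y (k + 1#) b≉0)))
    solution⁻¹ : ∀ d → d ≈ v → k + b * d ≈ 1#
    solution⁻¹ d d≈v = y≈x+z⇒x+y≈z (trans (*-congˡ d≈v) (x*[x⁻¹*y]≈y (k + 1#) b≉0))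

  ∑∑δ[k+bd≈1] : ∀ k → ∑ elems (λ b → ∑ elems (λ d → δ (k + b * d) 1#)) ≡ qℤ *ᶻ δ k 1# +ᶻ |F*|
  ∑∑δ[k+bd≈1] k = begin
    ∑ elems (λ b → ∑ elems (λ d → δ (k + b * d) 1#))                  ≡⟨ ∑-cong elems (∑δ[k+bd≈1] k) ⟩
    ∑ elems (λ b → δ b 0# *ᶻ (qℤ *ᶻ δ k 1#) +ᶻ 𝟙≉0 b)                 ≡⟨ ∑-+ elems (λ b → δ b 0# *ᶻ (qℤ *ᶻ δ k 1#)) 𝟙≉0 ⟩
    ∑ elems (λ b → δ b 0# *ᶻ (qℤ *ᶻ δ k 1#)) +ᶻ ∑ elems 𝟙≉0           ≡⟨ ≡.cong₂ _+ᶻ_ (∑-δ-* (λ _ → ≡.refl) 0#) ∑-𝟙≉0 ⟩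
    qℤ *ᶻ δ k 1# +ᶻ |F*|                                              ∎

  ∑∑∑N≡ : ∀ a → (∑ elems λ b → ∑ elems λ d → ∑ elems λ e → N a b d e)
               ≡ ∑ elems (λ e → (qℤ *ᶻ δ (a * e) 1# +ᶻ |F*|) *ᶻ L a e)
  ∑∑∑N≡ a = begin
    (∑ elems λ b → ∑ elems λ d → ∑ elems λ e → N a b d e)                   ≡⟨ ∑-cong elems (λ b → ∑-comm elems elems (N a b)) ⟩
    (∑ elems λ b → ∑ elems λ e → ∑ elems λ d → N a b d e)                   ≡⟨ ∑-comm elems elems (λ b e → ∑ elems λ d → N a b d e) ⟩
    (∑ elems λ e → ∑ elems λ b → ∑ elems λ d → N a b d e)                   ≡⟨ ∑-cong elems pull-L ⟩
    (∑ elems λ e → (∑ elems λ b → ∑ elems λ d → δ (a * e + b * d) 1#) *ᶻ L a e) ≡⟨ ∑-cong elems (λ e → ≡.cong (_*ᶻ L a e) (∑∑δ[k+bd≈1] (a * e))) ⟩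
    ∑ elems (λ e → (qℤ *ᶻ δ (a * e) 1# +ᶻ |F*|) *ᶻ L a e)                    ∎
    where
    pull-L : ∀ e → (∑ elems λ b → ∑ elems λ d → N a b d e) ≡ (∑ elems λ b → ∑ elems λ d → δ (a * e + b * d) 1#) *ᶻ L a e
    pull-L e = ≡.trans (∑-cong elems λ b → ∑-*ʳ elems (L a e) (λ d → δ (a * e + b * d) 1#))
                       (∑-*ʳ elems (L a e) (λ b → ∑ elems λ d → δ (a * e + b * d) 1#))

  L-cong : ∀ a → Congruent _≈_ _≡_ (L a)
  L-cong a e≈e′ = λχ-cong (*-congˡ (+-congʳ (+-congˡ e≈e′)))

  ∑δ[ae≈1]L : ∀ a → ∑ elems (λ e → δ (a * e) 1# *ᶻ L a e) ≡ 𝟙≉0 a *ᶻ L a (a ⁻¹)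
  ∑δ[ae≈1]L a with a ≟ 0#
  ... | yes a≈0 = begin
    ∑ elems (λ e → δ (a * e) 1# *ᶻ L a e)   ≡⟨ ∑-cong elems (λ e → ≡.trans (≡.cong (_*ᶻ L a e) (δ-≉ (ae≉1 e))) (ℤ.*-zeroˡ (L a e))) ⟩
    ∑ elems (λ _ → 0ℤ)                      ≡⟨ ∑-zero elems ⟩
    0ℤ                                      ≡⟨ ℤ.*-zeroˡ (L a (a ⁻¹)) ⟨
    0ℤ *ᶻ L a (a ⁻¹)                        ∎
    where
    ae≉1 : ∀ e → a * e ≉ 1#
    ae≉1 e ae≈1 = 1≉0 (trans (sym ae≈1) (trans (*-congʳ a≈0) (zeroˡ e)))
  ... | no  a≉0 = begin
    ∑ elems (λ e → δ (a * e) 1# *ᶻ L a e)   ≡⟨ ∑-cong elems (λ e → ≡.cong (_*ᶻ L a e) (δ-iff ⁻¹-unique (ae≈1 e))) ⟩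
    ∑ elems (λ e → δ e (a ⁻¹) *ᶻ L a e)     ≡⟨ ∑-δ-* (L-cong a) (a ⁻¹) ⟩
    L a (a ⁻¹)                              ≡⟨ ℤ.*-identityˡ (L a (a ⁻¹)) ⟨
    1ℤ *ᶻ L a (a ⁻¹)                        ∎
    where
    ae≈1 : ∀ e → e ≈ a ⁻¹ → a * e ≈ 1#
    ae≈1 e e≈a⁻¹ = trans (*-congˡ e≈a⁻¹) (⁻¹-inverse a a≉0)

  ∑L≡0 : ∀ a → ∑ elems (L a) ≡ 0ℤ
  ∑L≡0 a = ≡.trans (∑-cong elems (λ e → λχ-cong (affine e))) (∑λχ-affine≡0 (u * (a + 1#)) u≉0)
    where
    affine : ∀ e → u * (a + e + 1#) ≈ u * e + u * (a + 1#)
    affine e = solve 3 (λ u a e → u :* (a :+ e :+ con 1) := u :* e :+ u :* (a :+ con 1)) refl u a e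

  ∑[qδ+|F*|]L≡ : ∀ a → ∑ elems (λ e → (qℤ *ᶻ δ (a * e) 1# +ᶻ |F*|) *ᶻ L a e) ≡ qℤ *ᶻ (𝟙≉0 a *ᶻ L a (a ⁻¹))
  ∑[qδ+|F*|]L≡ a = begin
    ∑ elems (λ e → (qℤ *ᶻ δ (a * e) 1# +ᶻ |F*|) *ᶻ L a e)
      ≡⟨ ∑-cong elems (λ e → expand qℤ (δ (a * e) 1#) |F*| (L a e)) ⟩
    ∑ elems (λ e → qℤ *ᶻ (δ (a * e) 1# *ᶻ L a e) +ᶻ |F*| *ᶻ L a e)
      ≡⟨ ∑-+ elems (λ e → qℤ *ᶻ (δ (a * e) 1# *ᶻ L a e)) (λ e → |F*| *ᶻ L a e) ⟩
    ∑ elems (λ e → qℤ *ᶻ (δ (a * e) 1# *ᶻ L a e)) +ᶻ ∑ elems (λ e → |F*| *ᶻ L a e)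
      ≡⟨ ≡.cong₂ _+ᶻ_ (∑-*ˡ elems qℤ (λ e → δ (a * e) 1# *ᶻ L a e)) (∑-*ˡ elems |F*| (L a)) ⟩
    qℤ *ᶻ ∑ elems (λ e → δ (a * e) 1# *ᶻ L a e) +ᶻ |F*| *ᶻ ∑ elems (L a)
      ≡⟨ ≡.cong₂ (λ s t → qℤ *ᶻ s +ᶻ |F*| *ᶻ t) (∑δ[ae≈1]L a) (∑L≡0 a) ⟩
    qℤ *ᶻ (𝟙≉0 a *ᶻ L a (a ⁻¹)) +ᶻ |F*| *ᶻ 0ℤ
      ≡⟨ ≡.trans (≡.cong (qℤ *ᶻ (𝟙≉0 a *ᶻ L a (a ⁻¹)) +ᶻ_) (ℤ.*-zeroʳ |F*|)) (ℤ.+-identityʳ _) ⟩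
    qℤ *ᶻ (𝟙≉0 a *ᶻ L a (a ⁻¹))
      ∎
    where
    expand : ∀ q d n l → (q *ᶻ d +ᶻ n) *ᶻ l ≡ q *ᶻ (d *ᶻ l) +ᶻ n *ᶻ l
    expand = solve-∀

  L[a,a⁻¹]≡ : ∀ a → L a (a ⁻¹) ≡ λχ (u * a + u * a ⁻¹) *ᶻ λχ u
  L[a,a⁻¹]≡ a = ≡.trans (λχ-cong (solve 3 (λ u a a⁻¹ → u :* (a :+ a⁻¹ :+ con 1) := (u :* a :+ u :* a⁻¹) :+ u) refl u a (a ⁻¹)))
                        (λχ-+ (u * a + u * a ⁻¹) u)

  ∑O3λ[u·Tr]≡λ[u]qKl : ∑ O3 (λ w → λχ (u * Tr w)) ≡ λχ u *ᶻ qℤ *ᶻ Kl u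
  ∑O3λ[u·Tr]≡λ[u]qKl = begin
    ∑ O3 (λ w → λχ (u * Tr w))                                  ≡⟨ ∑O3≡∑⁹ ⟩
    ∑⁹ Γ                                                        ≡⟨ ∑⁹Γ≡∑⁴N ⟩
    (∑ elems λ a → ∑ elems λ b → ∑ elems λ d → ∑ elems λ e → N a b d e)
                                                                ≡⟨ ∑-cong elems (λ a → ≡.trans (∑∑∑N≡ a) (∑[qδ+|F*|]L≡ a)) ⟩
    ∑ elems (λ a → qℤ *ᶻ (𝟙≉0 a *ᶻ L a (a ⁻¹)))                 ≡⟨ ∑-*ˡ elems qℤ (λ a → 𝟙≉0 a *ᶻ L a (a ⁻¹)) ⟩
    qℤ *ᶻ ∑ elems (λ a → 𝟙≉0 a *ᶻ L a (a ⁻¹))                   ≡⟨ ≡.cong (qℤ *ᶻ_) (∑-elems* (λ a → L a (a ⁻¹))) ⟨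
    qℤ *ᶻ ∑ elems* (λ a → L a (a ⁻¹))                           ≡⟨ ≡.cong (qℤ *ᶻ_) (∑-cong elems* L[a,a⁻¹]≡) ⟩
    qℤ *ᶻ ∑ elems* (λ a → λχ (u * a + u * a ⁻¹) *ᶻ λχ u)        ≡⟨ ≡.cong (qℤ *ᶻ_) (∑-*ʳ elems* (λχ u) (λ a → λχ (u * a + u * a ⁻¹))) ⟩
    qℤ *ᶻ (∑ elems* (λ a → λχ (u * a + u * a ⁻¹)) *ᶻ λχ u)      ≡⟨ ≡.cong (λ s → qℤ *ᶻ (s *ᶻ λχ u)) ∑*λχ[ux+ux⁻¹]≡Kl ⟩
    qℤ *ᶻ (Kl u *ᶻ λχ u)                                        ≡⟨ reorder qℤ (Kl u) (λχ u) ⟩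
    λχ u *ᶻ qℤ *ᶻ Kl u                                          ∎
    where
    reorder : ∀ q k l → q *ᶻ (k *ᶻ l) ≡ l *ᶻ q *ᶻ k
    reorder = solve-∀

open import Data.Integer using (_*_)

corollary4 : ∀ {c ℓ : Level} (r : ℕ) → r ≥ 1 → (F : CommutativeRing c ℓ) → (K : FiniteField2 F r) →
    (a : CommutativeRing.Carrier F) → ¬ (CommutativeRing._≈_ F a (CommutativeRing.0# F)) →
    FF.Σℤ K (FF.O3 K) (λ w → FF.λχ K (CommutativeRing._*_ F a (FF.Tr K w)))
      ≡ FF.λχ K a * FF.qℤ K * FF.Kl K a
corollary4 r r≥1 F K = TraceSum.∑O3λ[u·Tr]≡λ[u]qKl K r≥1
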